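{- Let $D=A^2D_0<0$ be a discriminant with $A\in\mathbb{Z}^+$ and $D_0<0$ a fundamental discriminant. Let $Q\in\mathbb{Z}[X,Y]$ be a positive definite binary quadratic form of discriminant $D$, and suppose $Q$ is $\mathrm{SL}_2(\mathbb Z)$-equivalent to $A_Q\cdot Q'$ for some $A_Q\in\mathbb{Z}^+$ with $A_Q\mid A$ and some primitive positive definite form $Q'$ of discriminant $D/A_Q^2$. Then $\chi_{A^2,D_0}(Q)=\big(\frac{D_0}{A_Q}\big)$.
   Context: For a discriminant $d$, a fundamental discriminant $d_0$ with $dd_0<0$, and a positive definite form $Q=aX^2+bXY+cY^2$ of discriminant $dd_0$, the genus character is $\chi_{d,d_0}(Q):=\big(\frac{d_0}{r}\big)$ if $\gcd(a,b,c,d_0)=1$, where $r$ is any integer represented by $Q$ with $\gcd(r,d_0)=1$, and $\chi_{d,d_0}(Q):=0$ if $\gcd(a,b,c,d_0)>1$. $(\frac{\cdot}{\cdot})$ is the Kronecker symbol. A form is primitive if its coefficients have gcd $1$. -}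

module Defs where

open import Data.Nat as ℕ using (ℕ; zero; suc)
open import Data.Nat.Divisibility as ℕD using (_∣?_)
open import Data.Nat.GCD using (gcd)
open import Data.Integer as Int using (ℤ; +_; -[1+_]; _+_; _*_; -_; ∣_∣; _<_)
open import Data.Integer.DivMod using (_%ℕ_)
open import Data.Integer.Divisibility using (_∣_)
open import Data.Product using (Σ; ∃; _×_; _,_)
open import Data.Sum using (_⊎_)
open import Data.Bool using (Bool; true; false; if_then_else_)
open import Relation.Nullary using (¬_; does)
open import Relation.Binary.PropositionalEquality using (_≡_)

-- Kronecker symbol (a / n) for a n : ℤ, defined as usual:
--   * (a/p) for an odd prime p is the Legendre symbol (Euler's criterion),
--   * (a/2) = 0 if a even, 1 if a ≡ ±1 (mod 8), -1 if a ≡ ±3 (mod 8),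
--   * completely multiplicative in n > 0 (computed via prime factorisation),
--   * (a/-1) = -1 if a < 0, 1 otherwise,
--   * (a/0) = 1 if a = ±1, 0 otherwise.

kronPrime : ℤ → ℕ → ℤ
kronPrime a 0 = + 0
kronPrime a 1 = + 1
kronPrime a 2 with a %ℕ 8
... | 1 = + 1
... | 7 = + 1
... | 3 = - (+ 1)
... | 5 = - (+ 1)
... | _ = + 0
kronPrime a p@(suc (suc k)) with a %ℕ p
... | 0 = + 0
... | r = if does ((r ℕ.^ ((p ℕ.∸ 1) ℕ./ 2)) ℕ.% p ℕ.≟ 1) then + 1 else - (+ 1)

spfAux : ℕ → ℕ → ℕ → ℕ
spfAux zero d n = n
spfAux (suc f) d n = if does (d ∣? n) then d else spfAux f (suc d) n

spf : ℕ → ℕ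
spf n = spfAux n 2 n

divSafe : ℕ → ℕ → ℕ
divSafe n zero = n
divSafe n (suc d) = n ℕ./ suc d

-- (a / n) for n > 0, by peeling off smallest prime factors (fuel n suffices)
kronPosAux : ℕ → ℤ → ℕ → ℤ
kronPosAux zero a n = + 1
kronPosAux (suc f) a 0 = + 1
kronPosAux (suc f) a 1 = + 1
kronPosAux (suc f) a n@(suc (suc k)) =
  kronPrime a (spf n) * kronPosAux f a (divSafe n (spf n))

kronPos : ℤ → ℕ → ℤ
kronPos a n = kronPosAux n a n

kronecker : ℤ → ℤ → ℤ
kronecker a (+ 0) with ∣ a ∣
... | 1 = + 1
... | _ = + 0
kronecker a (+ (suc n)) = kronPos a (suc n)
kronecker (+ m) -[1+ n ] = kronPos (+ m) (suc n)
kronecker -[1+ m ] -[1+ n ] = - kronPos -[1+ m ] (suc n)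

SquareFree : ℤ → Set
SquareFree m = ∀ (k : ℕ) → (+ (k ℕ.* k)) ∣ m → k ≡ 1

FundamentalDiscriminant : ℤ → Set
FundamentalDiscriminant D =
  (D %ℕ 4 ≡ 1 × SquareFree D)
  ⊎ Σ ℤ (λ m → D ≡ + 4 * m × (m %ℕ 4 ≡ 2 ⊎ m %ℕ 4 ≡ 3) × SquareFree m)

record Form : Set where
  constructor form
  field
    a b c : ℤ
open Form public

disc : Form → ℤ
disc (form a b c) = b * b - + 4 * a * c
  where open Int using (_-_)

eval : Form → ℤ → ℤ → ℤ
eval (form a b c) x y = a * x * x + b * x * y + c * y * y

PosDef : Form → Set
PosDef Q = + 0 < a Q × disc Q < + 0

contentℕ : Form → ℕ
contentℕ (form a b c) = gcd ∣ a ∣ (gcd ∣ b ∣ ∣ c ∣)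

Primitive : Form → Set
Primitive Q = contentℕ Q ≡ 1

scale : ℤ → Form → Form
scale k (form a b c) = form (k * a) (k * b) (k * c)

-- Q ∘ (α β ; γ δ) : (X , Y) ↦ Q(αX + βY , γX + δY)
act : Form → ℤ → ℤ → ℤ → ℤ → Form
act Q@(form a b c) α β γ δ =
  form (eval Q α γ)
       (+ 2 * a * α * β + b * (α * δ + β * γ) + + 2 * c * γ * δ)
       (eval Q β δ)

SL2Equiv : Form → Form → Set
SL2Equiv Q R = Σ ℤ λ α → Σ ℤ λ β → Σ ℤ λ γ → Σ ℤ λ δ →
  (α * δ Int.- β * γ ≡ + 1) × act Q α β γ δ ≡ R

Represents : Form → ℤ → Set
Represents Q r = Σ ℤ λ x → Σ ℤ λ y → eval Q x y ≡ r

-- Genus character χ_{d,d₀}(Q) (for disc Q = d d₀ < 0, Q positive definite).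
-- Since "r is any integer represented by Q with gcd(r,d₀)=1" is asserted to
-- be independent of r, we express "χ_{d,d₀}(Q) = v" as a relation:
--   * if gcd(a,b,c,d₀) = 1: such an r exists and (d₀ / r) = v for every such r;
--   * if gcd(a,b,c,d₀) > 1: v = 0.
GenusCharIs : ℤ → ℤ → Form → ℤ → Set
GenusCharIs d d₀ Q v =
  (gcd (contentℕ Q) ∣ d₀ ∣ ≡ 1
     × Σ ℤ (λ r → Represents Q r × gcd ∣ r ∣ ∣ d₀ ∣ ≡ 1)
     × (∀ r → Represents Q r → gcd ∣ r ∣ ∣ d₀ ∣ ≡ 1 → kronecker d₀ r ≡ v))
  ⊎ (1 ℕ.< gcd (contentℕ Q) ∣ d₀ ∣ × v ≡ + 0)

-- Q is SL₂(ℤ)-equivalent to k Q′ with k = A_Q and Q′ primitive of discriminant f² D₀ (f = A / k), so the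
-- content of Q is k and the values of Q are the numbers k n with n a value of Q′. If gcd(k, D₀) > 1 both sides
-- vanish. Otherwise (D₀ / k n) = (D₀ / k) (D₀ / n), and (D₀ / n) = 1 for every value n prime to D₀ of a primitive
-- positive definite form of discriminant f² D₀: write n = g² n′ with n′ properly represented, move n′ into the
-- leading coefficient by an SL₂(ℤ) substitution and peel off its prime factors q one at a time. If q ∤ f² D₀,
-- then b² ≡ f² D₀ (mod 4q) makes D₀ a square mod q (mod 8 when q = 2); if q ∣ f, then q² divides the leading
-- coefficient and dividing it out leaves a primitive form of discriminant (f / q)² D₀.

module Submission where

open import Defs
open import Data.Nat as ℕ using (ℕ; zero; suc; NonZero; _≤_; _<_; z≤n; s≤s)
import Data.Nat.Properties as ℕP
open import Data.Nat.Divisibility as ℕD using (_∣_; _∣?_)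
import Data.Nat.DivMod as ℕDM
open import Data.Nat.Combinatorics using (_C_; nCk+nC[k+1]≡[n+1]C[k+1]; k>n⇒nCk≡0; nC1≡n; nCn≡1)
import Data.Nat.Tactic.RingSolver as ℕSolver
open import Data.Nat.Primality
open import Data.Nat.Primality.Factorisation using (PrimeFactorisation; factors; factorisationUnique; factorisationHasAllPrimeFactors; primeFactorisation[p])
open import Data.Nat.ListAction using (product)
open import Data.Nat.ListAction.Properties using (product-++; ∈⇒∣product)
open import Data.Nat.Coprimality as Cop using (Coprime)
open import Data.Nat.Induction using (<-rec)
open import Data.Nat.GCD as G using (gcd)
open import Data.Integer as ℤ using (ℤ; +_; -[1+_]; _+_; _*_; _-_; -_; _^_; _%ℕ_; _/ℕ_)
import Data.Integer.Properties as ℤP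
import Algebra.Properties.CommutativeSemigroup ℤP.*-commutativeSemigroup as ℤ*
open import Data.Integer.DivMod using (a≡a%ℕn+[a/ℕn]*n; n%ℕd<d)
open import Data.Integer.Divisibility.Signed as S using (divides) renaming (_∣_ to _∣ℤ_)
open import Data.Integer.Tactic.RingSolver using (solve-∀)
open import Data.Fin as Fin using (toℕ; fromℕ; inject₁)
import Data.Fin.Properties as FinP
open import Data.Vec.Functional using (Vector; init; last; tail)
import Algebra
import Algebra.Properties.CommutativeSemiring.Binomial ℤP.+-*-commutativeSemiring as Binomial
import Algebra.Properties.Monoid.Sum ℤP.+-0-monoid as MonoidSum
open import Algebra.Definitions.RawSemiring (Algebra.CommutativeSemiring.rawSemiring ℤP.+-*-commutativeSemiring)
  using (sum) renaming (_×_ to _×′_; _^_ to _^′_)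
open import Data.List using (List; []; _∷_; _++_)
open import Data.List.Membership.Propositional using (_∈_)
open import Data.List.Relation.Unary.All using (All; []; _∷_) renaming (lookup to lookupAll)
import Data.List.Relation.Unary.All.Properties as All
open import Data.List.Relation.Unary.Any using (here; there)
open import Data.List.Relation.Binary.Permutation.Propositional as ↭ using (_↭_)
open import Data.Product using (Σ; _×_; _,_; proj₁; proj₂)
open import Data.Sum using (_⊎_; inj₁; inj₂)
open import Data.Empty using (⊥; ⊥-elim)
open import Data.Bool using (true; false; if_then_else_)
open import Relation.Nullary using (¬_; Dec; yes; no; does)
open import Relation.Nullary.Decidable using (from-yes)
open import Relation.Binary.PropositionalEquality
open PrimeFactorisation using (isFactorisation; factorsPrime)

-- Multiplicativity of the Kronecker symbol

prime>1 : ∀ {p} → Prime p → 1 < p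
prime>1 {p} pp = ℕ.nonTrivial⇒n>1 p {{prime⇒nonTrivial pp}}

spfAux-correct : ∀ n f d → 1 < n → 1 < d → d Rough n → n < f ℕ.+ d →
                 spfAux f d n ∣ n × spfAux f d n Rough n × 1 < spfAux f d n
spfAux-correct n zero d 1<n 1<d r n<d =
  ℕD.∣-refl , (λ h → r (ℕD.hasNonTrivialDivisor-≤ h (ℕP.<⇒≤ n<d))) , 1<n
spfAux-correct n (suc f) d 1<n 1<d r n<f+d with d ∣? n
... | yes d∣n = d∣n , r , 1<d
... | no d∤n = spfAux-correct n f (suc d) 1<n (ℕP.m<n⇒m<1+n 1<d) (∤⇒rough-suc d∤n r)
                 (subst (n <_) (sym (ℕP.+-suc f d)) n<f+d)

1≤*⇒1≤ʳ : ∀ m n → 1 ≤ m ℕ.* n → 1 ≤ n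
1≤*⇒1≤ʳ m zero 1≤m*0 = ⊥-elim (ℕP.<-irrefl (sym (ℕP.*-zeroʳ m)) 1≤m*0)
1≤*⇒1≤ʳ m (suc n) _ = s≤s z≤n

spf-correct : ∀ n → 1 < n → spf n ∣ n × Prime (spf n)
spf-correct n 1<n with spfAux-correct n n 2 1<n (s≤s (s≤s z≤n)) 2-rough (ℕP.m<m+n n (s≤s z≤n))
... | d∣n , rough , 1<d = d∣n , rough∧∣⇒prime {{ℕ.n>1⇒nonTrivial 1<d}} rough d∣n

cofactor : ℕ → ℕ
cofactor n = divSafe n (spf n)

spf*cofactor≡n : ∀ n → 1 < n → spf n ℕ.* cofactor n ≡ n
spf*cofactor≡n n 1<n with spf n | spf-correct n 1<n
... | p | p∣n , pp with prime>1 pp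
... | s≤s (s≤s _) = ℕDM.m*[n/m]≡n p∣n

cofactor<n : ∀ n → 1 < n → cofactor n < n
cofactor<n n 1<n with spf n | spf-correct n 1<n
... | p | _ , pp with prime>1 pp
... | s≤s (s≤s _) = ℕDM.m/n<m n p {{ℕ.>-nonZero (ℕP.<-trans (s≤s z≤n) 1<n)}} (prime>1 pp)

spfFactorsAux : ℕ → ℕ → List ℕ
spfFactorsAux zero n = []
spfFactorsAux (suc f) 0 = []
spfFactorsAux (suc f) 1 = []
spfFactorsAux (suc f) n@(suc (suc _)) = spf n ∷ spfFactorsAux f (cofactor n)

kronProduct : ℤ → List ℕ → ℤ
kronProduct a [] = + 1
kronProduct a (p ∷ ps) = kronPrime a p * kronProduct a ps

kronPosAux≡kronProduct : ∀ f a n → kronPosAux f a n ≡ kronProduct a (spfFactorsAux f n)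
kronPosAux≡kronProduct zero a n = refl
kronPosAux≡kronProduct (suc f) a 0 = refl
kronPosAux≡kronProduct (suc f) a 1 = refl
kronPosAux≡kronProduct (suc f) a n@(suc (suc _)) =
  cong (kronPrime a (spf n) *_) (kronPosAux≡kronProduct f a (cofactor n))

spfFactorsAux-correct : ∀ f n → 1 ≤ n → n ≤ f →
                        n ≡ product (spfFactorsAux f n) × All Prime (spfFactorsAux f n)
spfFactorsAux-correct (suc f) 1 _ _ = refl , []
spfFactorsAux-correct (suc f) n@(suc (suc _)) _ n≤1+f =
  trans (sym (spf*cofactor≡n n 1<n)) (cong (spf n ℕ.*_) (proj₁ cofactorFactors)) ,
  proj₂ (spf-correct n 1<n) ∷ proj₂ cofactorFactors
  where
  1<n : 1 < n
  1<n = s≤s (s≤s z≤n)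
  1≤cofactor : 1 ≤ cofactor n
  1≤cofactor = 1≤*⇒1≤ʳ (spf n) (cofactor n) (subst (1 ≤_) (sym (spf*cofactor≡n n 1<n)) (s≤s z≤n))
  cofactorFactors = spfFactorsAux-correct f (cofactor n) 1≤cofactor (ℕP.≤-pred (ℕP.≤-trans (cofactor<n n 1<n) n≤1+f))

spfFactorisation : ∀ n → 1 ≤ n → PrimeFactorisation n
spfFactorisation n 1≤n = record
  { factors = spfFactorsAux n n
  ; isFactorisation = proj₁ (spfFactorsAux-correct n n 1≤n ℕP.≤-refl)
  ; factorsPrime = proj₂ (spfFactorsAux-correct n n 1≤n ℕP.≤-refl)
  }

kronProduct-↭ : ∀ a {ps qs} → ps ↭ qs → kronProduct a ps ≡ kronProduct a qs
kronProduct-↭ a ↭.refl = refl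
kronProduct-↭ a (↭.prep p ps↭qs) = cong (kronPrime a p *_) (kronProduct-↭ a ps↭qs)
kronProduct-↭ a (↭.swap p q ps↭qs) =
  trans (cong (λ k → kronPrime a p * (kronPrime a q * k)) (kronProduct-↭ a ps↭qs))
        (ℤ*.x∙yz≈y∙xz (kronPrime a p) (kronPrime a q) _)
kronProduct-↭ a (↭.trans ps↭qs qs↭rs) = trans (kronProduct-↭ a ps↭qs) (kronProduct-↭ a qs↭rs)

kronPos≡kronProduct : ∀ a {n} → 1 ≤ n → (F : PrimeFactorisation n) → kronPos a n ≡ kronProduct a (factors F)
kronPos≡kronProduct a {n} 1≤n F =
  trans (kronPosAux≡kronProduct n a n) (kronProduct-↭ a (factorisationUnique (spfFactorisation n 1≤n) F))

kronProduct-++ : ∀ a ps qs → kronProduct a (ps ++ qs) ≡ kronProduct a ps * kronProduct a qs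
kronProduct-++ a [] qs = sym (ℤP.*-identityˡ _)
kronProduct-++ a (p ∷ ps) qs =
  trans (cong (kronPrime a p *_) (kronProduct-++ a ps qs)) (sym (ℤP.*-assoc (kronPrime a p) _ _))

factorisation-* : ∀ {m n} → PrimeFactorisation m → PrimeFactorisation n → PrimeFactorisation (m ℕ.* n)
factorisation-* F G = record
  { factors = factors F ++ factors G
  ; isFactorisation = trans (cong₂ ℕ._*_ (isFactorisation F) (isFactorisation G))
                               (sym (product-++ (factors F) (factors G)))
  ; factorsPrime = All.++⁺ (factorsPrime F) (factorsPrime G)
  }

kronPos-* : ∀ a m n → 1 ≤ m → 1 ≤ n → kronPos a (m ℕ.* n) ≡ kronPos a m * kronPos a n
kronPos-* a m n 1≤m 1≤n = begin
  kronPos a (m ℕ.* n)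
    ≡⟨ kronPos≡kronProduct a (ℕP.*-mono-≤ 1≤m 1≤n) (factorisation-* F G) ⟩
  kronProduct a (factors F ++ factors G)
    ≡⟨ kronProduct-++ a (factors F) (factors G) ⟩
  kronProduct a (factors F) * kronProduct a (factors G)
    ≡⟨ sym (cong₂ _*_ (kronPos≡kronProduct a 1≤m F) (kronPos≡kronProduct a 1≤n G)) ⟩
  kronPos a m * kronPos a n ∎
  where
  open ≡-Reasoning
  F = spfFactorisation m 1≤m
  G = spfFactorisation n 1≤n

kronPos-prime : ∀ a p → Prime p → kronPos a p ≡ kronPrime a p
kronPos-prime a p pp =
  trans (kronPos≡kronProduct a (ℕP.<⇒≤ (prime>1 pp)) (primeFactorisation[p] pp)) (ℤP.*-identityʳ _)

∣remainder⇒∣ℤ : ∀ a r q n d → a ≡ + r + q * + n → d ∣ r → d ∣ n → + d ∣ℤ a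
∣remainder⇒∣ℤ a r q n d e d∣r d∣n = subst (+ d ∣ℤ_) (sym e)
  (S.∣m∣n⇒∣m+n {m = + r} (S.∣ᵤ⇒∣ {+ d} {+ r} d∣r) (S.∣n⇒∣m*n q (S.∣ᵤ⇒∣ {+ d} {+ n} d∣n)))

∣ℤ⇒∣remainder : ∀ a r q n d → a ≡ + r + q * + n → + d ∣ℤ a → d ∣ n → d ∣ r
∣ℤ⇒∣remainder a r q n d e d∣a d∣n = S.∣⇒∣ᵤ {+ d} {+ r}
  (S.∣m+n∣n⇒∣m {m = + r} (subst (+ d ∣ℤ_) e d∣a) (S.∣n⇒∣m*n q (S.∣ᵤ⇒∣ {+ d} {+ n} d∣n)))

2∤odd : ∀ r → r ℕ.% 2 ≡ 1 → ¬ 2 ∣ r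
2∤odd r r%2≡1 2∣r = ℕP.1+n≢0 (trans (sym r%2≡1) (ℕD.n∣m⇒m%n≡0 r 2 2∣r))

if-±1²≡1 : ∀ b → (if b then + 1 else - + 1) * (if b then + 1 else - + 1) ≡ + 1
if-±1²≡1 true = refl
if-±1²≡1 false = refl

kronPrime²≡1 : ∀ a p → Prime p → ¬ (+ p ∣ℤ a) → kronPrime a p * kronPrime a p ≡ + 1
kronPrime²≡1 a 0 pp _ = ⊥-elim (ℕP.n≮0 (prime>1 pp))
kronPrime²≡1 a 1 pp _ = ⊥-elim (ℕP.<-irrefl refl (prime>1 pp))
kronPrime²≡1 a 2 pp 2∤a with a %ℕ 8 | a≡a%ℕn+[a/ℕn]*n a 8 | n%ℕd<d a 8
... | 0 | e | _ = ⊥-elim (2∤a (∣remainder⇒∣ℤ a 0 (a /ℕ 8) 8 2 e (ℕD.divides 0 refl) (ℕD.divides 4 refl)))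
... | 1 | e | _ = refl
... | 2 | e | _ = ⊥-elim (2∤a (∣remainder⇒∣ℤ a 2 (a /ℕ 8) 8 2 e (ℕD.divides 1 refl) (ℕD.divides 4 refl)))
... | 3 | e | _ = refl
... | 4 | e | _ = ⊥-elim (2∤a (∣remainder⇒∣ℤ a 4 (a /ℕ 8) 8 2 e (ℕD.divides 2 refl) (ℕD.divides 4 refl)))
... | 5 | e | _ = refl
... | 6 | e | _ = ⊥-elim (2∤a (∣remainder⇒∣ℤ a 6 (a /ℕ 8) 8 2 e (ℕD.divides 3 refl) (ℕD.divides 4 refl)))
... | 7 | e | _ = refl
... | suc (suc (suc (suc (suc (suc (suc (suc _))))))) | _ | s≤s (s≤s (s≤s (s≤s (s≤s (s≤s (s≤s (s≤s ())))))))
kronPrime²≡1 a p@(suc (suc (suc _))) pp p∤a with a %ℕ p | a≡a%ℕn+[a/ℕn]*n a p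
... | zero | e = ⊥-elim (p∤a (∣remainder⇒∣ℤ a 0 (a /ℕ p) p p e (ℕD.divides 0 refl) ℕD.∣-refl))
... | suc r | e = if-±1²≡1 (does ((suc r ℕ.^ ((p ℕ.∸ 1) ℕ./ 2)) ℕ.% p ℕ.≟ 1))

kronPrime≡0 : ∀ a p → Prime p → + p ∣ℤ a → kronPrime a p ≡ + 0
kronPrime≡0 a 0 pp _ = refl
kronPrime≡0 a 1 pp _ = ⊥-elim (ℕP.<-irrefl refl (prime>1 pp))
kronPrime≡0 a 2 pp 2∣a with a %ℕ 8 | a≡a%ℕn+[a/ℕn]*n a 8
... | 1 | e = ⊥-elim (2∤odd 1 refl (∣ℤ⇒∣remainder a 1 (a /ℕ 8) 8 2 e 2∣a (ℕD.divides 4 refl)))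
... | 3 | e = ⊥-elim (2∤odd 3 refl (∣ℤ⇒∣remainder a 3 (a /ℕ 8) 8 2 e 2∣a (ℕD.divides 4 refl)))
... | 5 | e = ⊥-elim (2∤odd 5 refl (∣ℤ⇒∣remainder a 5 (a /ℕ 8) 8 2 e 2∣a (ℕD.divides 4 refl)))
... | 7 | e = ⊥-elim (2∤odd 7 refl (∣ℤ⇒∣remainder a 7 (a /ℕ 8) 8 2 e 2∣a (ℕD.divides 4 refl)))
... | 0 | _ = refl
... | 2 | _ = refl
... | 4 | _ = refl
... | 6 | _ = refl
... | suc (suc (suc (suc (suc (suc (suc (suc _))))))) | _ = refl
kronPrime≡0 a p@(suc (suc (suc _))) pp p∣a with a %ℕ p | a≡a%ℕn+[a/ℕn]*n a p | n%ℕd<d a p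
... | zero | _ | _ = refl
... | suc r | e | r<p =
  ⊥-elim (ℕP.<⇒≱ r<p (ℕD.∣⇒≤ (∣ℤ⇒∣remainder a (suc r) (a /ℕ p) p p e p∣a ℕD.∣-refl)))

kronProduct²≡1 : ∀ a ps → (∀ {p} → p ∈ ps → kronPrime a p * kronPrime a p ≡ + 1) →
                   kronProduct a ps * kronProduct a ps ≡ + 1
kronProduct²≡1 a [] _ = refl
kronProduct²≡1 a (p ∷ ps) units = begin
  (kronPrime a p * kronProduct a ps) * (kronPrime a p * kronProduct a ps)
    ≡⟨ ℤ*.interchange (kronPrime a p) (kronProduct a ps) (kronPrime a p) (kronProduct a ps) ⟩
  (kronPrime a p * kronPrime a p) * (kronProduct a ps * kronProduct a ps)
    ≡⟨ cong₂ _*_ (units (here refl)) (kronProduct²≡1 a ps (λ p∈ps → units (there p∈ps))) ⟩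
  + 1 ∎
  where open ≡-Reasoning

kronProduct≡0 : ∀ a {p ps} → p ∈ ps → kronPrime a p ≡ + 0 → kronProduct a ps ≡ + 0
kronProduct≡0 a {ps = _ ∷ qs} (here refl) p↦0 = trans (cong (_* kronProduct a qs) p↦0) (ℤP.*-zeroˡ (kronProduct a qs))
kronProduct≡0 a {ps = q ∷ _} (there p∈ps) p↦0 =
  trans (cong (kronPrime a q *_) (kronProduct≡0 a p∈ps p↦0)) (ℤP.*-zeroʳ (kronPrime a q))

kronPos²≡1 : ∀ a n → 1 ≤ n → Coprime n ℤ.∣ a ∣ → kronPos a n * kronPos a n ≡ + 1
kronPos²≡1 a n 1≤n n⊥a = subst (λ k → k * k ≡ + 1) (sym (kronPos≡kronProduct a 1≤n F))
  (kronProduct²≡1 a (factors F) unit)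
  where
  F = spfFactorisation n 1≤n
  unit : ∀ {p} → p ∈ factors F → kronPrime a p * kronPrime a p ≡ + 1
  unit p∈F = kronPrime²≡1 a _ pp (λ p∣a → ℕP.<-irrefl
    (sym (n⊥a (subst (_ ∣_) (sym (isFactorisation F)) (∈⇒∣product p∈F) , S.∣⇒∣ᵤ p∣a))) (prime>1 pp))
    where pp = lookupAll (factorsPrime F) p∈F

kronPos≡0 : ∀ a n p → 1 ≤ n → Prime p → p ∣ n → + p ∣ℤ a → kronPos a n ≡ + 0
kronPos≡0 a n p 1≤n pp p∣n p∣a = trans (kronPos≡kronProduct a 1≤n F)
  (kronProduct≡0 a (factorisationHasAllPrimeFactors pp (subst (p ∣_) (isFactorisation F) p∣n) (factorsPrime F))
                    (kronPrime≡0 a p pp p∣a))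
  where F = spfFactorisation n 1≤n

-- Congruences and Fermat's little theorem

infix 4 _≡_mod_
record _≡_mod_ (a b : ℤ) (m : ℕ) : Set where
  constructor congruent
  field modulus∣difference : + m ∣ℤ (a - b)
open _≡_mod_

≡mod-refl : ∀ {m} a → a ≡ a mod m
≡mod-refl a = congruent (divides (+ 0) (ℤP.+-inverseʳ a))

≡mod-sym : ∀ {m a b} → a ≡ b mod m → b ≡ a mod m
≡mod-sym {m} {a} {b} (congruent m∣a-b) = congruent (subst (+ m ∣ℤ_) (negate-difference a b) (S.∣m⇒∣-m m∣a-b))
  where negate-difference : ∀ a b → - (a - b) ≡ b - a
        negate-difference = solve-∀

≡mod-trans : ∀ {m a b c} → a ≡ b mod m → b ≡ c mod m → a ≡ c mod m
≡mod-trans {m} {a} {b} {c} (congruent m∣a-b) (congruent m∣b-c) =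
  congruent (subst (+ m ∣ℤ_) (telescope a b c) (S.∣m∣n⇒∣m+n m∣a-b m∣b-c))
  where telescope : ∀ a b c → (a - b) + (b - c) ≡ a - c
        telescope = solve-∀

≡mod-+ : ∀ {m a b c d} → a ≡ b mod m → c ≡ d mod m → a + c ≡ b + d mod m
≡mod-+ {m} {a} {b} {c} {d} (congruent m∣a-b) (congruent m∣c-d) =
  congruent (subst (+ m ∣ℤ_) (rearrange a b c d) (S.∣m∣n⇒∣m+n m∣a-b m∣c-d))
  where rearrange : ∀ a b c d → (a - b) + (c - d) ≡ (a + c) - (b + d)
        rearrange = solve-∀

≡mod-neg : ∀ {m a b} → a ≡ b mod m → - a ≡ - b mod m
≡mod-neg {m} {a} {b} (congruent m∣a-b) = congruent (subst (+ m ∣ℤ_) (rearrange a b) (S.∣m⇒∣-m m∣a-b))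
  where rearrange : ∀ a b → - (a - b) ≡ (- a) - (- b)
        rearrange = solve-∀

≡mod-* : ∀ {m a b c d} → a ≡ b mod m → c ≡ d mod m → a * c ≡ b * d mod m
≡mod-* {m} {a} {b} {c} {d} (congruent m∣a-b) (congruent m∣c-d) =
  congruent (subst (+ m ∣ℤ_) (rearrange a b c d) (S.∣m∣n⇒∣m+n (S.∣m⇒∣m*n c m∣a-b) (S.∣n⇒∣m*n b m∣c-d)))
  where rearrange : ∀ a b c d → (a - b) * c + b * (c - d) ≡ a * c - b * d
        rearrange = solve-∀

≡mod-^ : ∀ {m a b} k → a ≡ b mod m → a ^ k ≡ b ^ k mod m
≡mod-^ zero a≡b = ≡mod-refl (+ 1)
≡mod-^ (suc k) a≡b = ≡mod-* a≡b (≡mod-^ k a≡b)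

∣⇒≡0mod : ∀ {m a} → + m ∣ℤ a → a ≡ + 0 mod m
∣⇒≡0mod {m} {a} m∣a = congruent (subst (+ m ∣ℤ_) (sym (ℤP.+-identityʳ a)) m∣a)

≡0mod⇒∣ : ∀ {m a} → a ≡ + 0 mod m → + m ∣ℤ a
≡0mod⇒∣ {m} {a} (congruent m∣a-0) = subst (+ m ∣ℤ_) (ℤP.+-identityʳ a) m∣a-0

≡mod-∣ : ∀ {m n a b} → m ∣ n → a ≡ b mod n → a ≡ b mod m
≡mod-∣ {m} {n} m∣n (congruent n∣a-b) = congruent (S.∣-trans (S.∣ᵤ⇒∣ {+ m} {+ n} m∣n) n∣a-b)

%ℕ-≡mod : ∀ a n .{{_ : NonZero n}} → + (a %ℕ n) ≡ a mod n
%ℕ-≡mod a n = congruent (divides (- (a /ℕ n))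
  (trans (cong (λ v → + (a %ℕ n) - v) (a≡a%ℕn+[a/ℕn]*n a n)) (rearrange (+ (a %ℕ n)) (a /ℕ n) (+ n))))
  where rearrange : ∀ r q n → r - (r + q * n) ≡ (- q) * n
        rearrange = solve-∀

euclidsLemmaℤ : ∀ {p} a b → Prime p → + p ∣ℤ a * b → + p ∣ℤ a ⊎ + p ∣ℤ b
euclidsLemmaℤ {p} a b pp p∣ab
  with euclidsLemma ℤ.∣ a ∣ ℤ.∣ b ∣ pp (subst (p ∣_) (ℤP.abs-* a b) (S.∣⇒∣ᵤ {+ p} {a * b} p∣ab))
... | inj₁ p∣a = inj₁ (S.∣ᵤ⇒∣ {+ p} {a} p∣a)
... | inj₂ p∣b = inj₂ (S.∣ᵤ⇒∣ {+ p} {b} p∣b)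

prime∣square⇒prime∣ : ∀ {p} x → Prime p → + p ∣ℤ x * x → + p ∣ℤ x
prime∣square⇒prime∣ x pp p∣xx with euclidsLemmaℤ x x pp p∣xx
... | inj₁ p∣x = p∣x
... | inj₂ p∣x = p∣x

^-distribʳ-* : ∀ (x y : ℤ) (k : ℕ) → (x * y) ^ k ≡ x ^ k * y ^ k
^-distribʳ-* x y zero = refl
^-distribʳ-* x y (suc k) =
  trans (cong ((x * y) *_) (^-distribʳ-* x y k)) (ℤ*.interchange x y (x ^ k) (y ^ k))

pos-^ : ∀ n k → (+ n) ^ k ≡ + (n ℕ.^ k)
pos-^ n zero = refl
pos-^ n (suc k) = trans (cong (+ n *_) (pos-^ n k)) (sym (ℤP.pos-* n (n ℕ.^ k)))

[1+k]*[1+n]C[1+k]≡[1+n]*nCk : ∀ n k → suc k ℕ.* (suc n C suc k) ≡ suc n ℕ.* (n C k)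
[1+k]*[1+n]C[1+k]≡[1+n]*nCk zero zero = refl
[1+k]*[1+n]C[1+k]≡[1+n]*nCk zero (suc k) = begin
  suc (suc k) ℕ.* (1 C suc (suc k)) ≡⟨ cong (suc (suc k) ℕ.*_) (k>n⇒nCk≡0 {n = 1} {k = suc (suc k)} (s≤s (s≤s z≤n))) ⟩
  suc (suc k) ℕ.* 0                 ≡⟨ ℕP.*-zeroʳ (suc (suc k)) ⟩
  0                                 ≡⟨ cong (ℕ._+ 0) (k>n⇒nCk≡0 {n = 0} {k = suc k} (s≤s z≤n)) ⟨
  1 ℕ.* (0 C suc k)                 ∎
  where open ≡-Reasoning
[1+k]*[1+n]C[1+k]≡[1+n]*nCk (suc n) zero =
  trans (ℕP.+-identityʳ _) (trans (nC1≡n (suc (suc n))) (cong suc (sym (ℕP.*-identityʳ (suc n)))))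
[1+k]*[1+n]C[1+k]≡[1+n]*nCk (suc n) (suc j) = begin
  suc (suc j) ℕ.* (suc (suc n) C suc (suc j))
    ≡⟨ cong (suc (suc j) ℕ.*_) (nCk+nC[k+1]≡[n+1]C[k+1] (suc n) (suc j)) ⟨
  suc (suc j) ℕ.* (A ℕ.+ B)
    ≡⟨ distribute (suc j) A B ⟩
  suc j ℕ.* A ℕ.+ A ℕ.+ suc (suc j) ℕ.* B
    ≡⟨ cong₂ (λ u v → u ℕ.+ A ℕ.+ v) ([1+k]*[1+n]C[1+k]≡[1+n]*nCk n j) ([1+k]*[1+n]C[1+k]≡[1+n]*nCk n (suc j)) ⟩
  suc n ℕ.* (n C j) ℕ.+ A ℕ.+ suc n ℕ.* (n C suc j)
    ≡⟨ collect (suc n) (n C j) (n C suc j) A ⟩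
  suc n ℕ.* (n C j ℕ.+ n C suc j) ℕ.+ A
    ≡⟨ cong (λ v → suc n ℕ.* v ℕ.+ A) (nCk+nC[k+1]≡[n+1]C[k+1] n j) ⟩
  suc n ℕ.* A ℕ.+ A
    ≡⟨ ℕP.+-comm (suc n ℕ.* A) A ⟩
  suc (suc n) ℕ.* (suc n C suc j) ∎
  where
  open ≡-Reasoning
  A = suc n C suc j
  B = suc n C suc (suc j)
  distribute : ∀ j a b → suc j ℕ.* (a ℕ.+ b) ≡ j ℕ.* a ℕ.+ a ℕ.+ suc j ℕ.* b
  distribute = ℕSolver.solve-∀
  collect : ∀ m x y a → m ℕ.* x ℕ.+ a ℕ.+ m ℕ.* y ≡ m ℕ.* (x ℕ.+ y) ℕ.+ a
  collect = ℕSolver.solve-∀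

p∣pCk : ∀ p k → Prime p → 0 < k → k < p → p ∣ p C k
p∣pCk (suc m) (suc j) pp _ k<p
  with euclidsLemma (suc j) (suc m C suc j) pp
         (ℕD.divides (m C j) (trans ([1+k]*[1+n]C[1+k]≡[1+n]*nCk m j) (ℕP.*-comm (suc m) (m C j))))
... | inj₂ p∣pCk = p∣pCk
... | inj₁ p∣k = ⊥-elim (ℕP.<-irrefl refl (ℕP.<-≤-trans k<p (ℕD.∣⇒≤ p∣k)))

^′≡^ : ∀ x n → x ^′ n ≡ x ^ n
^′≡^ x zero = refl
^′≡^ x (suc n) = cong (x *_) (^′≡^ x n)

×′≡* : ∀ n y → n ×′ y ≡ + n * y
×′≡* zero y = sym (ℤP.*-zeroˡ y)
×′≡* (suc n) y = begin
  y + n ×′ y        ≡⟨ cong (λ t → y + t) (×′≡* n y) ⟩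
  y + + n * y       ≡⟨ cong (λ t → t + + n * y) (ℤP.*-identityˡ y) ⟨
  + 1 * y + + n * y ≡⟨ ℤP.*-distribʳ-+ y (+ 1) (+ n) ⟨
  + suc n * y       ∎
  where open ≡-Reasoning

1^′n≡1 : ∀ n → (+ 1) ^′ n ≡ + 1
1^′n≡1 n = trans (^′≡^ (+ 1) n) (ℤP.^-zeroˡ n)

∣-sum : ∀ d n (v : Vector ℤ n) → (∀ i → d ∣ℤ v i) → d ∣ℤ sum v
∣-sum d zero v _ = divides (+ 0) refl
∣-sum d (suc n) v d∣v = S.∣m∣n⇒∣m+n (d∣v Fin.zero) (∣-sum d n (tail v) (λ i → d∣v (Fin.suc i)))

-- In the binomial expansion of (x + 1) ^ p, every term other than x ^ p and 1 is divisible by p.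
freshmansDream : ∀ p x → Prime p → (x + + 1) ^ p ≡ x ^ p + + 1 mod p
freshmansDream zero x pp = ⊥-elim (ℕP.n≮0 (prime>1 pp))
freshmansDream p@(suc m) x pp = congruent (subst (+ p ∣ℤ_) middle≡ (∣-sum (+ p) m middle p∣middle))
  where
  term : Vector ℤ (suc p)
  term = Binomial.binomialTerm x (+ 1) p
  middle : Vector ℤ m
  middle = init (tail term)
  p∣middle : ∀ i → + p ∣ℤ middle i
  p∣middle i = subst (+ p ∣ℤ_) (sym (×′≡* (p C k) (Binomial.binomial x (+ 1) p (Fin.suc (inject₁ i)))))
    (S.∣m⇒∣m*n _ (S.∣ᵤ⇒∣ {+ p} {+ (p C k)} (p∣pCk p k pp (s≤s z≤n) (s≤s k≤m))))
    where
    k = suc (toℕ (inject₁ i))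
    k≤m : toℕ (inject₁ i) < m
    k≤m = subst (ℕ._< m) (sym (FinP.toℕ-inject₁ i)) (FinP.toℕ<n i)
  first : term Fin.zero ≡ + 1
  first = trans (×′≡* 1 _) (trans (ℤP.*-identityˡ _) (trans (ℤP.*-identityˡ _) (1^′n≡1 p)))
  final : last (tail term) ≡ x ^ p
  final = begin
    last (tail term)
      ≡⟨ ×′≡* (p C toℕ (Fin.suc (fromℕ m))) _ ⟩
    + (p C k) * (x ^′ k * (+ 1) ^′ (p ℕ.∸ k))
      ≡⟨ cong (λ j → + (p C j) * (x ^′ j * (+ 1) ^′ (p ℕ.∸ j))) (cong suc (FinP.toℕ-fromℕ m)) ⟩
    + (p C p) * (x ^′ p * (+ 1) ^′ (p ℕ.∸ p))
      ≡⟨ cong₂ (λ c u → + c * (x ^′ p * u)) (nCn≡1 p) (1^′n≡1 (p ℕ.∸ p)) ⟩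
    + 1 * (x ^′ p * + 1)
      ≡⟨ trans (ℤP.*-identityˡ _) (ℤP.*-identityʳ _) ⟩
    x ^′ p
      ≡⟨ ^′≡^ x p ⟩
    x ^ p ∎
    where
    open ≡-Reasoning
    k = toℕ (Fin.suc (fromℕ m))
  expansion : (x + + 1) ^ p ≡ + 1 + (sum middle + x ^ p)
  expansion = begin
    (x + + 1) ^ p                 ≡⟨ ^′≡^ (x + + 1) p ⟨
    (x + + 1) ^′ p                ≡⟨ Binomial.theorem p x (+ 1) ⟩
    term Fin.zero + sum (tail term) ≡⟨ cong₂ _+_ first (MonoidSum.sum-init-last (tail term)) ⟩
    + 1 + (sum middle + last (tail term)) ≡⟨ cong (λ t → + 1 + (sum middle + t)) final ⟩
    + 1 + (sum middle + x ^ p)    ∎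
    where open ≡-Reasoning
  middle≡ : sum middle ≡ (x + + 1) ^ p - (x ^ p + + 1)
  middle≡ = sym (trans (cong (λ v → v - (x ^ p + + 1)) expansion) (cancel (sum middle) (x ^ p)))
    where cancel : ∀ s y → (+ 1 + (s + y)) - (y + + 1) ≡ s
          cancel = solve-∀

fermat-ℕ : ∀ p n → Prime p → (+ n) ^ p ≡ + n mod p
fermat-ℕ zero n pp = ⊥-elim (ℕP.n≮0 (prime>1 pp))
fermat-ℕ (suc m) zero pp = subst (λ v → v ≡ + 0 mod suc m) (sym (ℤP.*-zeroˡ ((+ 0) ^ m))) (≡mod-refl (+ 0))
fermat-ℕ p (suc n) pp = subst (λ v → v ^ p ≡ v mod p) (sym (trans (cong +_ (ℕP.+-comm 1 n)) (ℤP.pos-+ n 1)))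
  (≡mod-trans (freshmansDream p (+ n) pp) (≡mod-+ (fermat-ℕ p n pp) (≡mod-refl (+ 1))))

fermat : ∀ p x → Prime p → x ^ p ≡ x mod p
fermat p x pp = ≡mod-trans (≡mod-^ p (≡mod-sym x%p≡x)) (≡mod-trans (fermat-ℕ p (x %ℕ p) pp) x%p≡x)
  where
  instance _ = prime⇒nonZero pp
  x%p≡x : + (x %ℕ p) ≡ x mod p
  x%p≡x = %ℕ-≡mod x p

fermatsLittleTheorem : ∀ p x → Prime p → ¬ (+ p ∣ℤ x) → x ^ (p ℕ.∸ 1) ≡ + 1 mod p
fermatsLittleTheorem zero x pp _ = ⊥-elim (ℕP.n≮0 (prime>1 pp))
fermatsLittleTheorem (suc m) x pp p∤x = fromEuclid (euclidsLemmaℤ x (x ^ m - + 1) pp p∣x[x^m-1])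
  where
  factor : ∀ x y → x * y - x ≡ x * (y - + 1)
  factor = solve-∀
  p∣x[x^m-1] : + suc m ∣ℤ x * (x ^ m - + 1)
  p∣x[x^m-1] = subst (+ suc m ∣ℤ_) (factor x (x ^ m)) (modulus∣difference (fermat (suc m) x pp))
  fromEuclid : + suc m ∣ℤ x ⊎ + suc m ∣ℤ x ^ m - + 1 → x ^ m ≡ + 1 mod suc m
  fromEuclid (inj₁ p∣x) = ⊥-elim (p∤x p∣x)
  fromEuclid (inj₂ p∣x^m-1) = congruent p∣x^m-1

-- Quadratic residues

+≡+1mod⇒%≡1 : ∀ j N → + N ≡ + 1 mod suc (suc j) → N ℕ.% suc (suc j) ≡ 1
+≡+1mod⇒%≡1 j zero (congruent m∣-1) with ℕD.∣1⇒≡1 (S.∣⇒∣ᵤ {+ suc (suc j)} { -[1+ 0 ]} m∣-1)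
... | ()
+≡+1mod⇒%≡1 j (suc M) (congruent m∣M) with S.∣⇒∣ᵤ {+ suc (suc j)} {+ M} m∣M
... | ℕD.divides t refl = ℕDM.[m+kn]%n≡m%n 1 t (suc (suc j))

≡+1mod⇒%ℕ≡1 : ∀ a j → a ≡ + 1 mod suc (suc j) → a %ℕ suc (suc j) ≡ 1
≡+1mod⇒%ℕ≡1 a j a≡1 = trans (sym (ℕDM.m<n⇒m%n≡m (n%ℕd<d a (suc (suc j)))))
  (+≡+1mod⇒%≡1 j _ (≡mod-trans (%ℕ-≡mod a (suc (suc j))) a≡1))

oddPrime-halves : ∀ q → Prime q → 2 < q → (q ℕ.∸ 1) ℕ./ 2 ℕ.+ (q ℕ.∸ 1) ℕ./ 2 ≡ q ℕ.∸ 1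
oddPrime-halves q pq 2<q with q ℕ.% 2 | ℕDM.m≡m%n+[m/n]*n q 2 | ℕDM.m%n<n q 2
... | 0 | q≡[q/2]*2 | _ with prime⇒irreducible pq (ℕD.divides (q ℕ./ 2) q≡[q/2]*2)
...   | inj₂ 2≡q = ⊥-elim (ℕP.<-irrefl 2≡q 2<q)
oddPrime-halves q pq 2<q | 1 | q≡1+[q/2]*2 | _ = begin
  (q ℕ.∸ 1) ℕ./ 2 ℕ.+ (q ℕ.∸ 1) ℕ./ 2 ≡⟨ cong (λ v → v ℕ.+ v) [q∸1]/2≡q/2 ⟩
  q ℕ./ 2 ℕ.+ q ℕ./ 2                 ≡⟨ cong (q ℕ./ 2 ℕ.+_) (ℕP.+-identityʳ (q ℕ./ 2)) ⟨
  2 ℕ.* (q ℕ./ 2)                     ≡⟨ ℕP.*-comm 2 (q ℕ./ 2) ⟩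
  q ℕ./ 2 ℕ.* 2                       ≡⟨ q∸1≡[q/2]*2 ⟨
  q ℕ.∸ 1                             ∎
  where
  open ≡-Reasoning
  q∸1≡[q/2]*2 : q ℕ.∸ 1 ≡ q ℕ./ 2 ℕ.* 2
  q∸1≡[q/2]*2 = cong (ℕ._∸ 1) q≡1+[q/2]*2
  [q∸1]/2≡q/2 : (q ℕ.∸ 1) ℕ./ 2 ≡ q ℕ./ 2
  [q∸1]/2≡q/2 = trans (cong (ℕ._/ 2) q∸1≡[q/2]*2) (ℕDM.m*n/n≡m (q ℕ./ 2) 2)
oddPrime-halves q pq 2<q | suc (suc _) | _ | s≤s (s≤s ())

kronPrime-odd≡1 : ∀ a j → let q = suc (suc (suc j)) in
                  ¬ (+ q ∣ℤ a) → a ^ ((q ℕ.∸ 1) ℕ./ 2) ≡ + 1 mod q → kronPrime a q ≡ + 1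
kronPrime-odd≡1 a j q∤a a^k≡1 with a %ℕ suc (suc (suc j)) | %ℕ-≡mod a (suc (suc (suc j)))
... | zero | 0≡a = ⊥-elim (q∤a (≡0mod⇒∣ (≡mod-sym 0≡a)))
... | suc r | r≡a = ≟1-selects-+1 (+≡+1mod⇒%≡1 (suc j) _
        (subst (λ v → v ≡ + 1 mod suc (suc (suc j))) (pos-^ (suc r) k) (≡mod-trans (≡mod-^ k r≡a) a^k≡1)))
  where k = suc (suc j) ℕ./ 2
        ≟1-selects-+1 : ∀ {n} → n ≡ 1 → (if does (n ℕ.≟ 1) then + 1 else - + 1) ≡ + 1
        ≟1-selects-+1 refl = refl

-- With k = (q - 1) / 2 and Fermat's little theorem twice: d ^ k ≡ (f² d) ^ k ≡ (b²) ^ k = b ^ (q - 1) ≡ 1.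
square-ratio⇒eulerCriterion : ∀ q d f b → Prime q → 2 < q → ¬ (+ q ∣ℤ d) → ¬ (+ q ∣ℤ f) →
                              f * f * d ≡ b * b mod q → d ^ ((q ℕ.∸ 1) ℕ./ 2) ≡ + 1 mod q
square-ratio⇒eulerCriterion q d f b pq 2<q q∤d q∤f f²d≡b² =
  ≡mod-trans d^k≡f^[q-1]d^k (≡mod-trans f^[q-1]d^k≡b^[q-1] (fermatsLittleTheorem q b pq q∤b))
  where
  k = (q ℕ.∸ 1) ℕ./ 2
  square^k : ∀ x → (x * x) ^ k ≡ x ^ (q ℕ.∸ 1)
  square^k x = trans (^-distribʳ-* x x k)
    (trans (sym (ℤP.^-distribˡ-+-* x k k)) (cong (x ^_) (oddPrime-halves q pq 2<q)))
  q∤b : ¬ (+ q ∣ℤ b)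
  q∤b q∣b with euclidsLemmaℤ (f * f) d pq (≡0mod⇒∣ (≡mod-trans f²d≡b² (∣⇒≡0mod (S.∣m⇒∣m*n b q∣b))))
  ... | inj₁ q∣f² = q∤f (prime∣square⇒prime∣ f pq q∣f²)
  ... | inj₂ q∣d = q∤d q∣d
  d^k≡f^[q-1]d^k : d ^ k ≡ f ^ (q ℕ.∸ 1) * d ^ k mod q
  d^k≡f^[q-1]d^k = subst (λ v → v ≡ f ^ (q ℕ.∸ 1) * d ^ k mod q) (ℤP.*-identityˡ (d ^ k))
    (≡mod-* (≡mod-sym (fermatsLittleTheorem q f pq q∤f)) (≡mod-refl (d ^ k)))
  f^[q-1]d^k≡b^[q-1] : f ^ (q ℕ.∸ 1) * d ^ k ≡ b ^ (q ℕ.∸ 1) mod q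
  f^[q-1]d^k≡b^[q-1] = subst₂ (λ u v → u ≡ v mod q)
    (trans (^-distribʳ-* (f * f) d k) (cong (_* d ^ k) (square^k f))) (square^k b) (≡mod-^ k f²d≡b²)

odd²≡1mod8 : ∀ x → ¬ (+ 2 ∣ℤ x) → x * x ≡ + 1 mod 8
odd²≡1mod8 x 2∤x with x %ℕ 4 | a≡a%ℕn+[a/ℕn]*n x 4 | n%ℕd<d x 4
... | 0 | e | _ = ⊥-elim (2∤x (∣remainder⇒∣ℤ x 0 (x /ℕ 4) 4 2 e (ℕD.divides 0 refl) (ℕD.divides 2 refl)))
... | 1 | e | _ = congruent (divides (t + + 2 * t * t) (trans (cong (λ v → v * v - + 1) e) (expand t)))
  where t = x /ℕ 4
        expand : ∀ t → (+ 1 + t * + 4) * (+ 1 + t * + 4) - + 1 ≡ (t + + 2 * t * t) * + 8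
        expand = solve-∀
... | 2 | e | _ = ⊥-elim (2∤x (∣remainder⇒∣ℤ x 2 (x /ℕ 4) 4 2 e (ℕD.divides 1 refl) (ℕD.divides 2 refl)))
... | 3 | e | _ = congruent (divides (+ 1 + + 3 * t + + 2 * t * t) (trans (cong (λ v → v * v - + 1) e) (expand t)))
  where t = x /ℕ 4
        expand : ∀ t → (+ 3 + t * + 4) * (+ 3 + t * + 4) - + 1 ≡ (+ 1 + + 3 * t + + 2 * t * t) * + 8
        expand = solve-∀
... | suc (suc (suc (suc _))) | _ | s≤s (s≤s (s≤s (s≤s ())))

square≡0or1mod4 : ∀ x → x * x ≡ + 0 mod 4 ⊎ x * x ≡ + 1 mod 4
square≡0or1mod4 x with + 2 S.∣? x
... | yes (divides t refl) = inj₁ (congruent (divides (t * t) (expand t)))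
  where expand : ∀ t → (t * + 2) * (t * + 2) - + 0 ≡ (t * t) * + 4
        expand = solve-∀
... | no 2∤x = inj₂ (≡mod-∣ (ℕD.divides 2 refl) (odd²≡1mod8 x 2∤x))

twice-odd≡2mod4 : ∀ x → ¬ (+ 2 ∣ℤ x) → + 2 * x ≡ + 2 mod 4
twice-odd≡2mod4 x 2∤x with x %ℕ 2 | a≡a%ℕn+[a/ℕn]*n x 2 | n%ℕd<d x 2
... | 0 | e | _ = ⊥-elim (2∤x (∣remainder⇒∣ℤ x 0 (x /ℕ 2) 2 2 e (ℕD.divides 0 refl) ℕD.∣-refl))
... | 1 | e | _ = congruent (divides (x /ℕ 2) (trans (cong (λ v → + 2 * v - + 2) e) (expand (x /ℕ 2))))
  where expand : ∀ t → + 2 * (+ 1 + t * + 2) - + 2 ≡ t * + 4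
        expand = solve-∀
... | suc (suc _) | _ | s≤s (s≤s ())

-- Squares are 0 or 1 mod 4, so f² d - b² ≡ f² - b² is 0 or ±1 mod 4, whereas -2k ≡ 2.
f²d≢b²-2·odd : ∀ f b k d → f * f * d ≡ b * b - + 2 * k → d ≡ + 1 mod 4 → ¬ (+ 2 ∣ℤ k) → ⊥
f²d≢b²-2·odd f b k d f²d≡b²-2k d≡1 2∤k = contradiction (square≡0or1mod4 f) (square≡0or1mod4 b)
  where
  vanishes : f * f * d - b * b + + 2 * k ≡ + 0
  vanishes = trans (cong (λ v → v - b * b + + 2 * k) f²d≡b²-2k) (cancel b k)
    where cancel : ∀ b k → b * b - + 2 * k - b * b + + 2 * k ≡ + 0
          cancel = solve-∀
  reduce : ∀ {r s} → f * f ≡ r mod 4 → b * b ≡ s mod 4 → + 0 ≡ r * + 1 - s + + 2 mod 4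
  reduce f²≡r b²≡s = subst (λ v → v ≡ _ mod 4) vanishes
    (≡mod-+ (≡mod-+ (≡mod-* f²≡r d≡1) (≡mod-neg b²≡s)) (twice-odd≡2mod4 k 2∤k))
  4∤ : ∀ {r} → + 0 ≡ + suc r mod 4 → r < 3 → ⊥
  4∤ {r} 0≡1+r r<3 = ℕD.>⇒∤ (s≤s r<3) (S.∣⇒∣ᵤ {+ 4} { -[1+ r ]} (modulus∣difference 0≡1+r))
  contradiction : _ → _ → ⊥
  contradiction (inj₁ f²≡0) (inj₁ b²≡0) = 4∤ (reduce f²≡0 b²≡0) (from-yes (1 ℕ.<? 3))
  contradiction (inj₁ f²≡0) (inj₂ b²≡1) = 4∤ (reduce f²≡0 b²≡1) (from-yes (0 ℕ.<? 3))
  contradiction (inj₂ f²≡1) (inj₁ b²≡0) = 4∤ (reduce f²≡1 b²≡0) (from-yes (2 ℕ.<? 3))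
  contradiction (inj₂ f²≡1) (inj₂ b²≡1) = 4∤ (reduce f²≡1 b²≡1) (from-yes (1 ℕ.<? 3))

kronPrime2≡1 : ∀ a → a ≡ + 1 mod 8 → kronPrime a 2 ≡ + 1
kronPrime2≡1 a a≡1 rewrite ≡+1mod⇒%ℕ≡1 a 6 a≡1 = refl

odd-square-ratio≡1mod8 : ∀ d f b → ¬ (+ 2 ∣ℤ f) → ¬ (+ 2 ∣ℤ b) → f * f * d ≡ b * b mod 8 → d ≡ + 1 mod 8
odd-square-ratio≡1mod8 d f b 2∤f 2∤b f²d≡b² =
  ≡mod-trans (subst (λ v → v ≡ f * f * d mod 8) (ℤP.*-identityˡ d)
                    (≡mod-* (≡mod-sym (odd²≡1mod8 f 2∤f)) (≡mod-refl d)))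
             (≡mod-trans f²d≡b² (odd²≡1mod8 b 2∤b))

-- Binary quadratic forms

eval-act : ∀ F α β γ δ x y → eval (act F α β γ δ) x y ≡ eval F (α * x + β * y) (γ * x + δ * y)
eval-act (form a b c) = substitute a b c
  where
  substitute : ∀ a b c α β γ δ x y →
    (a * α * α + b * α * γ + c * γ * γ) * x * x
      + (+ 2 * a * α * β + b * (α * δ + β * γ) + + 2 * c * γ * δ) * x * y
      + (a * β * β + b * β * δ + c * δ * δ) * y * y
    ≡ a * (α * x + β * y) * (α * x + β * y) + b * (α * x + β * y) * (γ * x + δ * y)
      + c * (γ * x + δ * y) * (γ * x + δ * y)
  substitute = solve-∀

disc-act : ∀ F α β γ δ → disc (act F α β γ δ) ≡ (α * δ - β * γ) * (α * δ - β * γ) * disc F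
disc-act (form a b c) = transform a b c
  where
  transform : ∀ a b c α β γ δ →
    (+ 2 * a * α * β + b * (α * δ + β * γ) + + 2 * c * γ * δ) * (+ 2 * a * α * β + b * (α * δ + β * γ) + + 2 * c * γ * δ)
      - + 4 * (a * α * α + b * α * γ + c * γ * γ) * (a * β * β + b * β * δ + c * δ * δ)
    ≡ (α * δ - β * γ) * (α * δ - β * γ) * (b * b - + 4 * a * c)
  transform = solve-∀

act-inverse : ∀ F α β γ δ → α * δ - β * γ ≡ + 1 → act (act F α β γ δ) δ (- β) (- γ) α ≡ F
act-inverse (form a b c) α β γ δ det≡1 = cong₃ (first a b c α β γ δ) (middle a b c α β γ δ) (third a b c α β γ δ)
  where
  first : ∀ a b c α β γ δ →
    (a * α * α + b * α * γ + c * γ * γ) * δ * δ + (+ 2 * a * α * β + b * (α * δ + β * γ) + + 2 * c * γ * δ) * δ * (- γ)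
      + (a * β * β + b * β * δ + c * δ * δ) * (- γ) * (- γ) ≡ a * (α * δ - β * γ) * (α * δ - β * γ)
  first = solve-∀
  middle : ∀ a b c α β γ δ →
    + 2 * (a * α * α + b * α * γ + c * γ * γ) * δ * (- β)
      + (+ 2 * a * α * β + b * (α * δ + β * γ) + + 2 * c * γ * δ) * (δ * α + (- β) * (- γ))
      + + 2 * (a * β * β + b * β * δ + c * δ * δ) * (- γ) * α ≡ b * (α * δ - β * γ) * (α * δ - β * γ)
  middle = solve-∀
  third : ∀ a b c α β γ δ →
    (a * α * α + b * α * γ + c * γ * γ) * (- β) * (- β) + (+ 2 * a * α * β + b * (α * δ + β * γ) + + 2 * c * γ * δ) * (- β) * α
      + (a * β * β + b * β * δ + c * δ * δ) * α * α ≡ c * (α * δ - β * γ) * (α * δ - β * γ)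
  third = solve-∀
  det² : ∀ x → x * (α * δ - β * γ) * (α * δ - β * γ) ≡ x
  det² x rewrite det≡1 = trans (cong (_* + 1) (ℤP.*-identityʳ x)) (ℤP.*-identityʳ x)
  cong₃ : ∀ {a′ b′ c′} → a′ ≡ a * (α * δ - β * γ) * (α * δ - β * γ) → b′ ≡ b * (α * δ - β * γ) * (α * δ - β * γ)
        → c′ ≡ c * (α * δ - β * γ) * (α * δ - β * γ) → form a′ b′ c′ ≡ form a b c
  cong₃ refl refl refl = cong₃′ (det² a) (det² b) (det² c)
    where cong₃′ : ∀ {a′ b′ c′} → a′ ≡ a → b′ ≡ b → c′ ≡ c → form a′ b′ c′ ≡ form a b c
          cong₃′ refl refl refl = refl

act-inverse-point : ∀ α β γ δ x y → α * δ - β * γ ≡ + 1 →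
  α * (δ * x - β * y) + β * ((- γ) * x + α * y) ≡ x × γ * (δ * x - β * y) + δ * ((- γ) * x + α * y) ≡ y
act-inverse-point α β γ δ x y det≡1 =
  trans (first α β γ δ x y) (trans (cong (_* x) det≡1) (ℤP.*-identityˡ x)) ,
  trans (second α β γ δ x y) (trans (cong (_* y) det≡1) (ℤP.*-identityˡ y))
  where
  first : ∀ α β γ δ x y → α * (δ * x - β * y) + β * ((- γ) * x + α * y) ≡ (α * δ - β * γ) * x
  first = solve-∀
  second : ∀ α β γ δ x y → γ * (δ * x - β * y) + δ * ((- γ) * x + α * y) ≡ (α * δ - β * γ) * y
  second = solve-∀

eval-scale : ∀ k F x y → eval (scale k F) x y ≡ k * eval F x y
eval-scale k (form a b c) x y = factor k a b c x y
  where factor : ∀ k a b c x y → (k * a) * x * x + (k * b) * x * y + (k * c) * y * y ≡ k * (a * x * x + b * x * y + c * y * y)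
        factor = solve-∀

eval-homogeneous : ∀ F x y g → eval F (x * g) (y * g) ≡ g * g * eval F x y
eval-homogeneous (form a b c) x y g = factor a b c x y g
  where factor : ∀ a b c x y g → a * (x * g) * (x * g) + b * (x * g) * (y * g) + c * (y * g) * (y * g)
                                 ≡ g * g * (a * x * x + b * x * y + c * y * y)
        factor = solve-∀

CommonDivisor : ℤ → Form → Set
CommonDivisor d F = d ∣ℤ a F × d ∣ℤ b F × d ∣ℤ c F

commonDivisor-act : ∀ {d} F α β γ δ → CommonDivisor d F → CommonDivisor d (act F α β γ δ)
commonDivisor-act {d} (form a b c) α β γ δ (divides qa refl , divides qb refl , divides qc refl) =
  divides (qa * α * α + qb * α * γ + qc * γ * γ) (factorOut qa qb qc d α γ) ,
  divides (+ 2 * qa * α * β + qb * (α * δ + β * γ) + + 2 * qc * γ * δ) (factorOutMiddle qa qb qc d α β γ δ) ,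
  divides (qa * β * β + qb * β * δ + qc * δ * δ) (factorOut qa qb qc d β δ)
  where
  factorOut : ∀ a b c d α γ → (a * d) * α * α + (b * d) * α * γ + (c * d) * γ * γ ≡ (a * α * α + b * α * γ + c * γ * γ) * d
  factorOut = solve-∀
  factorOutMiddle : ∀ a b c d α β γ δ → + 2 * (a * d) * α * β + (b * d) * (α * δ + β * γ) + + 2 * (c * d) * γ * δ
                                        ≡ (+ 2 * a * α * β + b * (α * δ + β * γ) + + 2 * c * γ * δ) * d
  factorOutMiddle = solve-∀

content-commonDivisor : ∀ F → CommonDivisor (+ contentℕ F) F
content-commonDivisor (form a b c) =
  S.∣ᵤ⇒∣ {+ g} {a} (G.gcd[m,n]∣m ℤ.∣ a ∣ _) ,
  S.∣ᵤ⇒∣ {+ g} {b} (ℕD.∣-trans (G.gcd[m,n]∣n ℤ.∣ a ∣ _) (G.gcd[m,n]∣m ℤ.∣ b ∣ ℤ.∣ c ∣)) ,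
  S.∣ᵤ⇒∣ {+ g} {c} (ℕD.∣-trans (G.gcd[m,n]∣n ℤ.∣ a ∣ _) (G.gcd[m,n]∣n ℤ.∣ b ∣ ℤ.∣ c ∣))
  where g = contentℕ (form a b c)

commonDivisor⇒∣content : ∀ {d} F → CommonDivisor (+ d) F → d ∣ contentℕ F
commonDivisor⇒∣content {d} (form a b c) (d∣a , d∣b , d∣c) =
  G.gcd-greatest (S.∣⇒∣ᵤ {+ d} {a} d∣a) (G.gcd-greatest (S.∣⇒∣ᵤ {+ d} {b} d∣b) (S.∣⇒∣ᵤ {+ d} {c} d∣c))

primitive⇒commonDivisor≡1 : ∀ {d} F → Primitive F → CommonDivisor (+ d) F → d ≡ 1
primitive⇒commonDivisor≡1 F prim d∣F = ℕD.∣1⇒≡1 (subst (_ ∣_) prim (commonDivisor⇒∣content F d∣F))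

commonDivisor≡1⇒primitive : ∀ F → (∀ d → CommonDivisor (+ d) F → d ≡ 1) → Primitive F
commonDivisor≡1⇒primitive F divisors≡1 = divisors≡1 (contentℕ F) (content-commonDivisor F)

content-act : ∀ F α β γ δ → α * δ - β * γ ≡ + 1 → contentℕ (act F α β γ δ) ≡ contentℕ F
content-act F α β γ δ det≡1 = ℕD.∣-antisym
  (commonDivisor⇒∣content F (subst (CommonDivisor _) (act-inverse F α β γ δ det≡1)
    (commonDivisor-act (act F α β γ δ) δ (- β) (- γ) α (content-commonDivisor (act F α β γ δ)))))
  (commonDivisor⇒∣content (act F α β γ δ) (commonDivisor-act F α β γ δ (content-commonDivisor F)))

content-scale : ∀ k F → contentℕ (scale (+ k) F) ≡ k ℕ.* contentℕ F
content-scale k (form a b c) = begin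
  gcd ℤ.∣ + k * a ∣ (gcd ℤ.∣ + k * b ∣ ℤ.∣ + k * c ∣)
    ≡⟨ cong₂ gcd (ℤP.abs-* (+ k) a) (cong₂ gcd (ℤP.abs-* (+ k) b) (ℤP.abs-* (+ k) c)) ⟩
  gcd (k ℕ.* ℤ.∣ a ∣) (gcd (k ℕ.* ℤ.∣ b ∣) (k ℕ.* ℤ.∣ c ∣))
    ≡⟨ cong (gcd (k ℕ.* ℤ.∣ a ∣)) (G.c*gcd[m,n]≡gcd[cm,cn] k ℤ.∣ b ∣ ℤ.∣ c ∣) ⟨
  gcd (k ℕ.* ℤ.∣ a ∣) (k ℕ.* gcd ℤ.∣ b ∣ ℤ.∣ c ∣)
    ≡⟨ G.c*gcd[m,n]≡gcd[cm,cn] k ℤ.∣ a ∣ (gcd ℤ.∣ b ∣ ℤ.∣ c ∣) ⟨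
  k ℕ.* gcd ℤ.∣ a ∣ (gcd ℤ.∣ b ∣ ℤ.∣ c ∣) ∎
  where open ≡-Reasoning

square≡+∣∣² : ∀ z → z * z ≡ + (ℤ.∣ z ∣ ℕ.* ℤ.∣ z ∣)
square≡+∣∣² (+ n) = sym (ℤP.pos-* n n)
square≡+∣∣² -[1+ n ] = refl

-- Completing the square: 4 a Q(x, y) = (2 a x + b y)² - disc Q · y², a sum of squares when disc Q < 0.
posDef-eval-nonNeg : ∀ F x y → PosDef F → Σ ℕ λ k → eval F x y ≡ + k
posDef-eval-nonNeg (form (+ zero) b c) x y (ℤ.+<+ () , _)
posDef-eval-nonNeg F@(form (+ suc a′) b c) x y (_ , disc<0) = sign (eval F x y) refl (disc F) refl disc<0
  where
  completeSquare : ∀ a b c x y → + 4 * a * (a * x * x + b * x * y + c * y * y) ≡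
    (+ 2 * a * x + b * y) * (+ 2 * a * x + b * y) + (- (b * b - + 4 * a * c)) * (y * y)
  completeSquare = solve-∀
  s = + 2 * + suc a′ * x + b * y
  sign : ∀ v → eval F x y ≡ v → ∀ D → disc F ≡ D → D ℤ.< + 0 → Σ ℕ λ k → eval F x y ≡ + k
  sign (+ k) eval≡k _ _ _ = k , eval≡k
  sign _ _ (+ _) _ (ℤ.+<+ ())
  sign -[1+ k ] eval≡v -[1+ d ] disc≡D _ = ⊥-elim (negative≢nonNegative (begin
    + 4 * + suc a′ * -[1+ k ]                  ≡⟨ cong (+ 4 * + suc a′ *_) eval≡v ⟨
    + 4 * + suc a′ * eval F x y                ≡⟨ completeSquare (+ suc a′) b c x y ⟩
    s * s + (- disc F) * (y * y)               ≡⟨ cong₂ (λ u w → u + (- w) * (y * y)) (square≡+∣∣² s) disc≡D ⟩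
    + ∣s∣² + + suc d * (y * y)                 ≡⟨ cong (λ w → + ∣s∣² + + suc d * w) (square≡+∣∣² y) ⟩
    + ∣s∣² + + suc d * + ∣y∣²                  ≡⟨ cong (λ w → + ∣s∣² + w) (ℤP.pos-* (suc d) ∣y∣²) ⟨
    + ∣s∣² + + (suc d ℕ.* ∣y∣²)                ≡⟨ ℤP.pos-+ ∣s∣² (suc d ℕ.* ∣y∣²) ⟨
    + (∣s∣² ℕ.+ suc d ℕ.* ∣y∣²)                ∎))
    where
    open ≡-Reasoning
    ∣s∣² = ℤ.∣ s ∣ ℕ.* ℤ.∣ s ∣
    ∣y∣² = ℤ.∣ y ∣ ℕ.* ℤ.∣ y ∣
    negative≢nonNegative : ∀ {m n} → -[1+ m ] ≢ + n
    negative≢nonNegative ()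

-- Descent on the leading coefficient

∣⇒∣ℤ : ∀ {d n} → d ∣ n → + d ∣ℤ + n
∣⇒∣ℤ {d} {n} = S.∣ᵤ⇒∣ {+ d} {+ n}

∣ℤ⇒∣ : ∀ {d n} → + d ∣ℤ + n → d ∣ n
∣ℤ⇒∣ {d} {n} = S.∣⇒∣ᵤ {+ d} {+ n}

coprime-∣ˡ : ∀ {m n k} → m ∣ n → Coprime n k → Coprime m k
coprime-∣ˡ m∣n n⊥k (i∣m , i∣k) = n⊥k (ℕD.∣-trans i∣m m∣n , i∣k)

coprime-*ˡ : ∀ {m n k} → Coprime m k → Coprime n k → Coprime (m ℕ.* n) k
coprime-*ˡ {m} {n} {k} m⊥k n⊥k {i} (i∣mn , i∣k) =
  m⊥k (Cop.coprime-divisor (coprime-∣ˡ i∣k (Cop.sym n⊥k)) (subst (i ∣_) (ℕP.*-comm m n) i∣mn) , i∣k)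

prime∣coprime⇒∤ : ∀ {q n} d → Prime q → q ∣ n → Coprime n ℤ.∣ d ∣ → ¬ (+ q ∣ℤ d)
prime∣coprime⇒∤ {q} d pq q∣n n⊥d q∣d = ℕP.<-irrefl (sym (n⊥d (q∣n , S.∣⇒∣ᵤ {+ q} {d} q∣d))) (prime>1 pq)

disc-leading : ∀ b c f d q m {n} → q ℕ.* m ≡ n → disc (form (+ n) b c) ≡ f * f * d →
               f * f * d - b * b ≡ (- (+ 4 * + m * c)) * + q
disc-leading b c f d q m {n} q*m≡n disc≡ = begin
  f * f * d - b * b                    ≡⟨ cong (_- b * b) disc≡ ⟨
  b * b - + 4 * + n * c - b * b         ≡⟨ cong (λ v → b * b - + 4 * v * c - b * b) (trans (cong +_ (sym q*m≡n)) (ℤP.pos-* q m)) ⟩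
  b * b - + 4 * (+ q * + m) * c - b * b ≡⟨ rearrange b c (+ q) (+ m) ⟩
  (- (+ 4 * + m * c)) * + q             ∎
  where
  open ≡-Reasoning
  rearrange : ∀ b c q m → b * b - + 4 * (q * m) * c - b * b ≡ (- (+ 4 * m * c)) * q
  rearrange = solve-∀

leadingPrime-kronPrime≡1 : ∀ b c f d {q m n} → Prime q → q ℕ.* m ≡ n → disc (form (+ n) b c) ≡ f * f * d →
                           ¬ (+ q ∣ℤ f * f * d) → kronPrime d q ≡ + 1
leadingPrime-kronPrime≡1 _ _ _ _ {q = 0} pq _ _ _ = ⊥-elim (ℕP.n≮0 (prime>1 pq))
leadingPrime-kronPrime≡1 _ _ _ _ {q = 1} pq _ _ _ = ⊥-elim (ℕP.<-irrefl refl (prime>1 pq))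
leadingPrime-kronPrime≡1 b c f d {2} {m} pq q*m≡n disc≡ 2∤f²d =
  kronPrime2≡1 d (odd-square-ratio≡1mod8 d f b 2∤f 2∤b f²d≡b²)
  where
  2∤f : ¬ (+ 2 ∣ℤ f)
  2∤f 2∣f = 2∤f²d (S.∣m⇒∣m*n d (S.∣m⇒∣m*n f 2∣f))
  2∤b : ¬ (+ 2 ∣ℤ b)
  2∤b 2∣b = 2∤f²d (subst (+ 2 ∣ℤ_) (cancel (f * f * d) (b * b))
    (S.∣m∣n⇒∣m+n (S.∣m⇒∣m*n b 2∣b) (divides (- (+ 4 * + m * c)) (disc-leading b c f d 2 m q*m≡n disc≡))))
    where cancel : ∀ x y → y + (x - y) ≡ x
          cancel = solve-∀
  f²d≡b² : f * f * d ≡ b * b mod 8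
  f²d≡b² = congruent (divides (- (+ m * c)) (trans (disc-leading b c f d 2 m q*m≡n disc≡) (regroup (+ m) c)))
    where regroup : ∀ m c → (- (+ 4 * m * c)) * + 2 ≡ (- (m * c)) * + 8
          regroup = solve-∀
leadingPrime-kronPrime≡1 b c f d {q@(suc (suc (suc j)))} {m} pq q*m≡n disc≡ q∤f²d =
  kronPrime-odd≡1 d j q∤d (square-ratio⇒eulerCriterion q d f b pq (s≤s (s≤s (s≤s z≤n))) q∤d q∤f
    (congruent (divides (- (+ 4 * + m * c)) (disc-leading b c f d q m q*m≡n disc≡))))
  where
  q∤f : ¬ (+ q ∣ℤ f)
  q∤f q∣f = q∤f²d (S.∣m⇒∣m*n d (S.∣m⇒∣m*n f q∣f))
  q∤d : ¬ (+ q ∣ℤ d)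
  q∤d q∣d = q∤f²d (S.∣n⇒∣m*n (f * f) q∣d)

leadingPrime-transfer : ∀ b c f d {q m n} → Prime q → q ℕ.* m ≡ n → Primitive (form (+ n) b c) →
  disc (form (+ n) b c) ≡ f * f * d → ¬ (+ q ∣ℤ f * f * d) →
  Primitive (form (+ m) b (c * + q)) × disc (form (+ m) b (c * + q)) ≡ f * f * d
leadingPrime-transfer b c f d {q} {m} {n} pq q*m≡n prim disc≡ q∤f²d =
  commonDivisor≡1⇒primitive _ divisor≡1 ,
  trans (regroup b c (+ q) (+ m)) (trans (cong (λ v → b * b - + 4 * v * c) +q*+m≡+n) disc≡)
  where
  m∣n : m ∣ n
  m∣n = ℕD.divides q (sym q*m≡n)
  +q*+m≡+n : + q * + m ≡ + n
  +q*+m≡+n = trans (sym (ℤP.pos-* q m)) (cong +_ q*m≡n)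
  regroup : ∀ b c q m → b * b - + 4 * m * (c * q) ≡ b * b - + 4 * (q * m) * c
  regroup = solve-∀
  divisor≡1 : ∀ e → CommonDivisor (+ e) (form (+ m) b (c * + q)) → e ≡ 1
  divisor≡1 e (e∣m , e∣b , e∣cq) with prime⇒irreducible pq e∣q
    where
    g = gcd e ℤ.∣ c ∣
    g≡1 : g ≡ 1
    g≡1 = primitive⇒commonDivisor≡1 (form (+ n) b c) prim
      (∣⇒∣ℤ (ℕD.∣-trans (G.gcd[m,n]∣m e ℤ.∣ c ∣) (ℕD.∣-trans (∣ℤ⇒∣ e∣m) m∣n)) ,
       S.∣-trans (∣⇒∣ℤ (G.gcd[m,n]∣m e ℤ.∣ c ∣)) e∣b ,
       S.∣ᵤ⇒∣ {+ g} {c} (G.gcd[m,n]∣n e ℤ.∣ c ∣))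
    e∣q : e ∣ q
    e∣q = Cop.coprime-divisor (Cop.gcd≡1⇒coprime g≡1) (subst (e ∣_) (ℤP.abs-* c (+ q)) (S.∣⇒∣ᵤ {+ e} {c * + q} e∣cq))
  ... | inj₁ e≡1 = e≡1
  ... | inj₂ refl = ⊥-elim (q∤f²d (subst (+ q ∣ℤ_) disc≡
          (S.∣m∣n⇒∣m-n (S.∣m⇒∣m*n b e∣b) (S.∣m⇒∣m*n c (S.∣n⇒∣m*n (+ 4) (∣⇒∣ℤ (ℕD.∣-trans (∣ℤ⇒∣ e∣m) m∣n)))))))

-- From 4 m c = q (b₁² - f₁² d): for odd q this is Euclid's lemma; for q = 2 an odd m would make
-- f₁² d ≡ b₁² - 2 (odd) (mod 4), impossible when d ≡ 1 (mod 4).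
conductorPrime∣cofactor : ∀ {q m c b₁ f₁ d} → (¬ (+ 2 ∣ℤ d) → d ≡ + 1 mod 4) → Prime q → ¬ (+ q ∣ℤ d) →
  ¬ (+ q ∣ℤ c) → + 4 * + m * c ≡ + q * (b₁ * b₁ - f₁ * f₁ * d) → q ∣ m
conductorPrime∣cofactor {q} {m} _ _ _ _ _ with q ∣? m
... | yes q∣m = q∣m
conductorPrime∣cofactor {0} _ pq _ _ _ | no _ = ⊥-elim (ℕP.n≮0 (prime>1 pq))
conductorPrime∣cofactor {1} _ pq _ _ _ | no _ = ⊥-elim (ℕP.<-irrefl refl (prime>1 pq))
conductorPrime∣cofactor {2} {m} {c} {b₁} {f₁} {d} odd⇒≡1 pq 2∤d 2∤c 4mc≡ | no 2∤m =
  ⊥-elim (f²d≢b²-2·odd f₁ b₁ (+ m * c) d f₁²d≡ (odd⇒≡1 2∤d) 2∤mc)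
  where
  2∤mc : ¬ (+ 2 ∣ℤ + m * c)
  2∤mc 2∣mc with euclidsLemmaℤ (+ m) c pq 2∣mc
  ... | inj₁ 2∣m = 2∤m (∣ℤ⇒∣ 2∣m)
  ... | inj₂ 2∣c = 2∤c 2∣c
  f₁²d≡ : f₁ * f₁ * d ≡ b₁ * b₁ - + 2 * (+ m * c)
  f₁²d≡ = ℤP.*-cancelˡ-≡ (+ 2) _ _ (begin
    + 2 * (f₁ * f₁ * d)                          ≡⟨ expand₁ f₁ d b₁ ⟩
    + 2 * (b₁ * b₁) - + 2 * (b₁ * b₁ - f₁ * f₁ * d) ≡⟨ cong (λ v → + 2 * (b₁ * b₁) - v) 4mc≡ ⟨
    + 2 * (b₁ * b₁) - + 4 * + m * c              ≡⟨ expand₂ b₁ (+ m) c ⟨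
    + 2 * (b₁ * b₁ - + 2 * (+ m * c))            ∎)
    where
    open ≡-Reasoning
    expand₁ : ∀ f d b → + 2 * (f * f * d) ≡ + 2 * (b * b) - + 2 * (b * b - f * f * d)
    expand₁ = solve-∀
    expand₂ : ∀ b m c → + 2 * (b * b - + 2 * (m * c)) ≡ + 2 * (b * b) - + 4 * m * c
    expand₂ = solve-∀
conductorPrime∣cofactor {q@(suc (suc (suc _)))} {m} {c} {b₁} {f₁} {d} _ pq _ q∤c 4mc≡ | no q∤m
  with euclidsLemmaℤ (+ 4 * + m) c pq (divides (b₁ * b₁ - f₁ * f₁ * d) (trans 4mc≡ (ℤP.*-comm (+ q) _)))
... | inj₂ q∣c = ⊥-elim (q∤c q∣c)
... | inj₁ q∣4m with euclidsLemmaℤ (+ 4) (+ m) pq q∣4m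
...   | inj₂ q∣m = ⊥-elim (q∤m (∣ℤ⇒∣ q∣m))
...   | inj₁ q∣4 with euclidsLemma 2 2 pq (∣ℤ⇒∣ q∣4)
...     | inj₁ q∣2 = ⊥-elim (ℕD.>⇒∤ (s≤s (s≤s (s≤s z≤n))) q∣2)
...     | inj₂ q∣2 = ⊥-elim (ℕD.>⇒∤ (s≤s (s≤s (s≤s z≤n))) q∣2)

record ConductorReduction (d : ℤ) (q n : ℕ) (c : ℤ) : Set where
  field
    m₁ : ℕ
    b₁ f₁ : ℤ
    n≡q²m₁ : n ≡ q ℕ.* q ℕ.* m₁
    primitive₁ : Primitive (form (+ m₁) b₁ c)
    disc₁ : disc (form (+ m₁) b₁ c) ≡ f₁ * f₁ * d

conductorPrime-reduce : ∀ b c f d {q m n} → (¬ (+ 2 ∣ℤ d) → d ≡ + 1 mod 4) → Prime q → q ℕ.* m ≡ n →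
  Primitive (form (+ n) b c) → disc (form (+ n) b c) ≡ f * f * d → Coprime n ℤ.∣ d ∣ → + q ∣ℤ f * f * d →
  ConductorReduction d q n c
conductorPrime-reduce b c f d {q} {m} {n} odd⇒≡1 pq q*m≡n prim disc≡ n⊥d q∣f²d = reduce q∣f q∣b
  where
  instance _ = prime⇒nonZero pq
  q∣n : q ∣ n
  q∣n = ℕD.divides m (trans (sym q*m≡n) (ℕP.*-comm q m))
  q∤d : ¬ (+ q ∣ℤ d)
  q∤d = prime∣coprime⇒∤ d pq q∣n n⊥d
  q∣f : + q ∣ℤ f
  q∣f with euclidsLemmaℤ (f * f) d pq q∣f²d
  ... | inj₁ q∣f² = prime∣square⇒prime∣ f pq q∣f²
  ... | inj₂ q∣d = ⊥-elim (q∤d q∣d)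
  q∣b : + q ∣ℤ b
  q∣b = prime∣square⇒prime∣ b pq (subst (+ q ∣ℤ_) (solveFor (b * b) (+ 4 * + n * c) (f * f * d) disc≡)
          (S.∣m∣n⇒∣m+n q∣f²d (S.∣m⇒∣m*n c (S.∣n⇒∣m*n (+ 4) (∣⇒∣ℤ q∣n)))))
    where solveFor : ∀ x y z → x - y ≡ z → z + y ≡ x
          solveFor x y z refl = simplify x y
            where simplify : ∀ x y → x - y + y ≡ x
                  simplify = solve-∀
  q∤c : ¬ (+ q ∣ℤ c)
  q∤c q∣c = ℕP.<-irrefl (sym (primitive⇒commonDivisor≡1 (form (+ n) b c) prim (∣⇒∣ℤ q∣n , q∣b , q∣c))) (prime>1 pq)
  +n≡+q*+m : + n ≡ + q * + m
  +n≡+q*+m = trans (cong +_ (sym q*m≡n)) (ℤP.pos-* q m)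
  reduce : + q ∣ℤ f → + q ∣ℤ b → ConductorReduction d q n c
  reduce (divides f₁ refl) (divides b₁ refl) = record
    { m₁ = m₁ ; b₁ = b₁ ; f₁ = f₁ ; n≡q²m₁ = n≡q²m₁ ; primitive₁ = primitive₁ ; disc₁ = disc₁ }
    where
    4mc≡ : + 4 * + m * c ≡ + q * (b₁ * b₁ - f₁ * f₁ * d)
    4mc≡ = ℤP.*-cancelˡ-≡ (+ q) _ _ (begin
      + q * (+ 4 * + m * c)                           ≡⟨ regroup (+ q) (+ m) c ⟩
      + 4 * (+ q * + m) * c                           ≡⟨ cong (λ v → + 4 * v * c) +n≡+q*+m ⟨
      + 4 * + n * c                                   ≡⟨ solveFor (b₁ * + q * (b₁ * + q)) _ _ disc≡ ⟩
      b₁ * + q * (b₁ * + q) - f₁ * + q * (f₁ * + q) * d ≡⟨ factor b₁ f₁ (+ q) d ⟩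
      + q * (+ q * (b₁ * b₁ - f₁ * f₁ * d))             ∎)
      where
      open ≡-Reasoning
      regroup : ∀ q m c → q * (+ 4 * m * c) ≡ + 4 * (q * m) * c
      regroup = solve-∀
      solveFor : ∀ x y z → x - y ≡ z → y ≡ x - z
      solveFor x y z refl = simplify x y
        where simplify : ∀ x y → y ≡ x - (x - y)
              simplify = solve-∀
      factor : ∀ b f q d → b * q * (b * q) - f * q * (f * q) * d ≡ q * (q * (b * b - f * f * d))
      factor = solve-∀
    q∣m : q ∣ m
    q∣m = conductorPrime∣cofactor {b₁ = b₁} {f₁ = f₁} odd⇒≡1 pq q∤d q∤c 4mc≡
    m₁ = m ℕ./ q
    m≡m₁*q : m ≡ m₁ ℕ.* q
    m≡m₁*q = sym (ℕDM.m/n*n≡m q∣m)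
    n≡q²m₁ : n ≡ q ℕ.* q ℕ.* m₁
    n≡q²m₁ = trans (sym q*m≡n) (trans (cong (q ℕ.*_) (trans m≡m₁*q (ℕP.*-comm m₁ q))) (sym (ℕP.*-assoc q q m₁)))
    primitive₁ : Primitive (form (+ m₁) b₁ c)
    primitive₁ = commonDivisor≡1⇒primitive (form (+ m₁) b₁ c) λ e (e∣m₁ , e∣b₁ , e∣c) →
      primitive⇒commonDivisor≡1 (form (+ n) (b₁ * + q) c) prim
        (∣⇒∣ℤ (ℕD.∣-trans (∣ℤ⇒∣ e∣m₁) (ℕD.divides (q ℕ.* q) n≡q²m₁)) ,
         S.∣m⇒∣m*n (+ q) e∣b₁ , e∣c)
    disc₁ : disc (form (+ m₁) b₁ c) ≡ f₁ * f₁ * d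
    disc₁ = ℤP.*-cancelˡ-≡ (+ q) _ _ (ℤP.*-cancelˡ-≡ (+ q) _ _ (begin
      + q * (+ q * (b₁ * b₁ - + 4 * + m₁ * c))          ≡⟨ expand b₁ (+ m₁) c (+ q) ⟩
      b₁ * + q * (b₁ * + q) - + 4 * (+ q * (+ q * + m₁)) * c ≡⟨ cong (λ v → b₁ * + q * (b₁ * + q) - + 4 * v * c) +q*+q*+m₁≡+n ⟩
      disc (form (+ n) (b₁ * + q) c)                    ≡⟨ disc≡ ⟩
      f₁ * + q * (f₁ * + q) * d                         ≡⟨ factor f₁ (+ q) d ⟩
      + q * (+ q * (f₁ * f₁ * d))                       ∎))
      where
      open ≡-Reasoning
      +q*+q*+m₁≡+n : + q * (+ q * + m₁) ≡ + n
      +q*+q*+m₁≡+n = trans (cong (+ q *_) (sym (ℤP.pos-* q m₁)))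
        (trans (sym (ℤP.pos-* q (q ℕ.* m₁))) (cong +_ (trans (sym (ℕP.*-assoc q q m₁)) (sym n≡q²m₁))))
      expand : ∀ b m c q → q * (q * (b * b - + 4 * m * c)) ≡ b * q * (b * q) - + 4 * (q * (q * m)) * c
      expand = solve-∀
      factor : ∀ f q d → f * q * (f * q) * d ≡ q * (q * (f * f * d))
      factor = solve-∀

bézoutℤ : ∀ x y → Coprime ℤ.∣ x ∣ ℤ.∣ y ∣ → Σ ℤ λ u → Σ ℤ λ w → u * x + w * y ≡ + 1
bézoutℤ x y |x|⊥|y| with Cop.coprime-Bézout |x|⊥|y| | sign x | sign y
  where
  sign : ∀ z → Σ ℤ λ s → + ℤ.∣ z ∣ ≡ s * z
  sign (+ n) = + 1 , sym (ℤP.*-identityˡ (+ n))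
  sign -[1+ n ] = - + 1 , sym (ℤP.-1*i≡-i -[1+ n ])
... | G.Bézout.+- u w 1+w|y|≡u|x| | s , |x|≡sx | t , |y|≡ty = + u * s , - (+ w) * t , (begin
  + u * s * x + - (+ w) * t * y         ≡⟨ regroup (+ u) s x (+ w) t y ⟩
  + u * (s * x) - + w * (t * y)         ≡⟨ cong₂ (λ p q → + u * p - + w * q) (sym |x|≡sx) (sym |y|≡ty) ⟩
  + u * + ℤ.∣ x ∣ - + w * + ℤ.∣ y ∣     ≡⟨ cong₂ _-_ (sym (ℤP.pos-* u _)) (sym (ℤP.pos-* w _)) ⟩
  + (u ℕ.* ℤ.∣ x ∣) - + (w ℕ.* ℤ.∣ y ∣) ≡⟨ cong (λ v → + v - + (w ℕ.* ℤ.∣ y ∣)) (sym 1+w|y|≡u|x|) ⟩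
  + (1 ℕ.+ w ℕ.* ℤ.∣ y ∣) - + (w ℕ.* ℤ.∣ y ∣) ≡⟨ cong (_- + (w ℕ.* ℤ.∣ y ∣)) (ℤP.pos-+ 1 (w ℕ.* ℤ.∣ y ∣)) ⟩
  + 1 + + (w ℕ.* ℤ.∣ y ∣) - + (w ℕ.* ℤ.∣ y ∣) ≡⟨ cancel (+ 1) (+ (w ℕ.* ℤ.∣ y ∣)) ⟩
  + 1 ∎)
  where
  open ≡-Reasoning
  regroup : ∀ u s x w t y → u * s * x + - w * t * y ≡ u * (s * x) - w * (t * y)
  regroup = solve-∀
  cancel : ∀ a b → a + b - b ≡ a
  cancel = solve-∀
... | G.Bézout.-+ u w 1+u|x|≡w|y| | s , |x|≡sx | t , |y|≡ty = - (+ u) * s , + w * t , (begin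
  - (+ u) * s * x + + w * t * y         ≡⟨ regroup (+ u) s x (+ w) t y ⟩
  + w * (t * y) - + u * (s * x)         ≡⟨ cong₂ (λ p q → + w * q - + u * p) (sym |x|≡sx) (sym |y|≡ty) ⟩
  + w * + ℤ.∣ y ∣ - + u * + ℤ.∣ x ∣     ≡⟨ cong₂ _-_ (sym (ℤP.pos-* w _)) (sym (ℤP.pos-* u _)) ⟩
  + (w ℕ.* ℤ.∣ y ∣) - + (u ℕ.* ℤ.∣ x ∣) ≡⟨ cong (λ v → + v - + (u ℕ.* ℤ.∣ x ∣)) (sym 1+u|x|≡w|y|) ⟩
  + (1 ℕ.+ u ℕ.* ℤ.∣ x ∣) - + (u ℕ.* ℤ.∣ x ∣) ≡⟨ cong (_- + (u ℕ.* ℤ.∣ x ∣)) (ℤP.pos-+ 1 (u ℕ.* ℤ.∣ x ∣)) ⟩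
  + 1 + + (u ℕ.* ℤ.∣ x ∣) - + (u ℕ.* ℤ.∣ x ∣) ≡⟨ cancel (+ 1) (+ (u ℕ.* ℤ.∣ x ∣)) ⟩
  + 1 ∎)
  where
  open ≡-Reasoning
  regroup : ∀ u s x w t y → - u * s * x + w * t * y ≡ w * (t * y) - u * (s * x)
  regroup = solve-∀
  cancel : ∀ a b → a + b - b ≡ a
  cancel = solve-∀

record GcdDecomposition (x y : ℤ) : Set where
  field
    g : ℕ
    1≤g : 1 ≤ g
    x′ y′ : ℤ
    x≡x′g : x ≡ x′ * + g
    y≡y′g : y ≡ y′ * + g
    coprime : Coprime ℤ.∣ x′ ∣ ℤ.∣ y′ ∣

gcdDecomposition : ∀ x y → 0 < gcd ℤ.∣ x ∣ ℤ.∣ y ∣ → GcdDecomposition x y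
gcdDecomposition x y 0<g with gcd ℤ.∣ x ∣ ℤ.∣ y ∣ in gcd≡g | G.gcd[m,n]∣m ℤ.∣ x ∣ ℤ.∣ y ∣ | G.gcd[m,n]∣n ℤ.∣ x ∣ ℤ.∣ y ∣
... | suc g₀ | g∣x | g∣y with S.∣ᵤ⇒∣ {+ suc g₀} {x} g∣x | S.∣ᵤ⇒∣ {+ suc g₀} {y} g∣y
... | divides x′ refl | divides y′ refl = record
  { g = g ; 1≤g = s≤s z≤n ; x′ = x′ ; y′ = y′ ; x≡x′g = refl ; y≡y′g = refl ; coprime = x′⊥y′ }
  where
  g = suc g₀
  x′⊥y′ : Coprime ℤ.∣ x′ ∣ ℤ.∣ y′ ∣
  x′⊥y′ {e} (e∣x′ , e∣y′) = ℕD.∣1⇒≡1 (ℕD.*-cancelʳ-∣ g (subst (e ℕ.* g ∣_) (trans gcd≡g (sym (ℕP.*-identityˡ g)))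
    (G.gcd-greatest (subst (e ℕ.* g ∣_) (sym (ℤP.abs-* x′ (+ g))) (ℕD.*-monoˡ-∣ g e∣x′))
                    (subst (e ℕ.* g ∣_) (sym (ℤP.abs-* y′ (+ g))) (ℕD.*-monoˡ-∣ g e∣y′)))))

module LeadingCoefficient (d : ℤ) (odd⇒≡1 : ¬ (+ 2 ∣ℤ d) → d ≡ + 1 mod 4) where

  KroneckerTrivial : ℕ → Set
  KroneckerTrivial n = ∀ b c f → Primitive (form (+ n) b c) → disc (form (+ n) b c) ≡ f * f * d →
                       Coprime n ℤ.∣ d ∣ → kronPos d n ≡ + 1

  leadingPrime-step : ∀ {q m n} → Prime q → q ℕ.* m ≡ n → 1 ≤ n → KroneckerTrivial m →
                      ∀ b c f → Primitive (form (+ n) b c) → disc (form (+ n) b c) ≡ f * f * d →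
                      Coprime n ℤ.∣ d ∣ → ¬ (+ q ∣ℤ f * f * d) → kronPos d n ≡ + 1
  leadingPrime-step {q} {m} {n} pq q*m≡n 1≤n ih b c f prim disc≡ n⊥d q∤f²d = begin
    kronPos d n                   ≡⟨ cong (kronPos d) (sym q*m≡n) ⟩
    kronPos d (q ℕ.* m)           ≡⟨ kronPos-* d q m (ℕP.<⇒≤ (prime>1 pq)) 1≤m ⟩
    kronPos d q * kronPos d m     ≡⟨ cong₂ _*_ (trans (kronPos-prime d q pq) (leadingPrime-kronPrime≡1 b c f d pq q*m≡n disc≡ q∤f²d))
                                               (ih b (c * + q) f (proj₁ transferred) (proj₂ transferred) (coprime-∣ˡ m∣n n⊥d)) ⟩
    + 1 * + 1                     ∎
    where
    open ≡-Reasoning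
    m∣n : m ∣ n
    m∣n = ℕD.divides q (sym q*m≡n)
    1≤m = 1≤*⇒1≤ʳ q m (subst (1 ≤_) (sym q*m≡n) 1≤n)
    transferred = leadingPrime-transfer b c f d pq q*m≡n prim disc≡ q∤f²d

  conductorPrime-step : ∀ {q m n} → Prime q → q ℕ.* m ≡ n → 1 ≤ n → (∀ {k} → k < n → KroneckerTrivial k) →
                        ∀ b c f → Primitive (form (+ n) b c) → disc (form (+ n) b c) ≡ f * f * d →
                        Coprime n ℤ.∣ d ∣ → + q ∣ℤ f * f * d → kronPos d n ≡ + 1
  conductorPrime-step {q} {m} {n} pq q*m≡n 1≤n rec b c f prim disc≡ n⊥d q∣f²d = begin
    kronPos d n                                   ≡⟨ cong (kronPos d) n≡q²m₁ ⟩
    kronPos d (q ℕ.* q ℕ.* m₁)                    ≡⟨ kronPos-* d (q ℕ.* q) m₁ (ℕP.*-mono-≤ 1≤q 1≤q) 1≤m₁ ⟩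
    kronPos d (q ℕ.* q) * kronPos d m₁            ≡⟨ cong (_* kronPos d m₁) (kronPos-* d q q 1≤q 1≤q) ⟩
    kronPos d q * kronPos d q * kronPos d m₁      ≡⟨ cong₂ _*_ (trans (cong (λ k → k * k) (kronPos-prime d q pq)) (kronPrime²≡1 d q pq q∤d))
                                                           (rec m₁<n b₁ c f₁ primitive₁ disc₁ (coprime-∣ˡ m₁∣n n⊥d)) ⟩
    + 1 * + 1                                     ∎
    where
    open ≡-Reasoning
    open ConductorReduction (conductorPrime-reduce b c f d odd⇒≡1 pq q*m≡n prim disc≡ n⊥d q∣f²d)
    1≤q = ℕP.<⇒≤ (prime>1 pq)
    q∤d = prime∣coprime⇒∤ d pq (ℕD.divides m (trans (sym q*m≡n) (ℕP.*-comm q m))) n⊥d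
    m₁∣n : m₁ ∣ n
    m₁∣n = ℕD.divides (q ℕ.* q) n≡q²m₁
    1≤m₁ = 1≤*⇒1≤ʳ (q ℕ.* q) m₁ (subst (1 ≤_) n≡q²m₁ 1≤n)
    m₁<n : m₁ < n
    m₁<n = subst (m₁ <_) (trans (ℕP.*-comm m₁ (q ℕ.* q)) (sym n≡q²m₁))
             (ℕP.m<m*n m₁ (q ℕ.* q) {{ℕ.>-nonZero 1≤m₁}} (ℕP.*-mono-≤ (prime>1 pq) 1≤q))

  kronPos-leading≡1 : ∀ n → KroneckerTrivial n
  kronPos-leading≡1 = <-rec KroneckerTrivial step
    where
    step : ∀ n → (∀ {k} → k < n → KroneckerTrivial k) → KroneckerTrivial n
    step 0 _ _ _ _ _ _ _ = refl  -- junk value: kronPos d 0 = + 1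
    step 1 _ _ _ _ _ _ _ = refl
    step n@(suc (suc _)) rec b c f prim disc≡ n⊥d = byCase (+ q S.∣? f * f * d)
      where
      1<n : 1 < n
      1<n = s≤s (s≤s z≤n)
      q = spf n
      pq = proj₂ (spf-correct n 1<n)
      q*m≡n = spf*cofactor≡n n 1<n
      byCase : Dec (+ q ∣ℤ f * f * d) → kronPos d n ≡ + 1
      byCase (no q∤f²d) = leadingPrime-step pq q*m≡n (ℕP.<⇒≤ 1<n) (rec (cofactor<n n 1<n)) b c f prim disc≡ n⊥d q∤f²d
      byCase (yes q∣f²d) = conductorPrime-step pq q*m≡n (ℕP.<⇒≤ 1<n) rec b c f prim disc≡ n⊥d q∣f²d

  kronPos-properValue≡1 : ∀ F f → Primitive F → disc F ≡ f * f * d → ∀ x y u w → u * x + w * y ≡ + 1 →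
                          ∀ n → eval F x y ≡ + n → Coprime n ℤ.∣ d ∣ → kronPos d n ≡ + 1
  kronPos-properValue≡1 F f prim disc≡ x y u w bézout n Fxy≡n n⊥d =
    kronPos-leading≡1 n (b G) (c G) f
      (trans (cong contentℕ (sym G≡)) (trans (content-act F x (- w) y u det≡1) prim))
      (trans (cong disc (sym G≡)) (trans (disc-act F x (- w) y u)
        (trans (cong (λ t → t * t * disc F) det≡1) (trans (ℤP.*-identityˡ (disc F)) disc≡))))
      n⊥d
    where
    G = act F x (- w) y u
    G≡ : G ≡ form (+ n) (b G) (c G)
    G≡ = cong (λ t → form t (b G) (c G)) Fxy≡n
    det≡1 : x * u - (- w) * y ≡ + 1
    det≡1 = trans (rearrange x u w y) bézout
      where rearrange : ∀ x u w y → x * u - (- w) * y ≡ u * x + w * y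
            rearrange = solve-∀

  kronPos-value≡1 : ∀ F f → Primitive F → PosDef F → disc F ≡ f * f * d →
                    ∀ x y n → eval F x y ≡ + n → Coprime n ℤ.∣ d ∣ → kronPos d n ≡ + 1
  kronPos-value≡1 F f prim posDef disc≡ x y zero _ _ = refl  -- junk value: kronPos d 0 = + 1
  kronPos-value≡1 F f prim posDef disc≡ x y n@(suc _) Fxy≡n n⊥d = begin
    kronPos d n                         ≡⟨ cong (kronPos d) n≡g²n′ ⟩
    kronPos d (g ℕ.* g ℕ.* n′)          ≡⟨ kronPos-* d (g ℕ.* g) n′ (ℕP.*-mono-≤ 1≤g 1≤g) 1≤n′ ⟩
    kronPos d (g ℕ.* g) * kronPos d n′  ≡⟨ cong (_* kronPos d n′) (kronPos-* d g g 1≤g 1≤g) ⟩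
    kronPos d g * kronPos d g * kronPos d n′
      ≡⟨ cong₂ _*_ (kronPos²≡1 d g 1≤g (coprime-∣ˡ g∣n n⊥d))
                   (kronPos-properValue≡1 F f prim disc≡ x′ y′ u w bézout n′ F[x′,y′]≡n′
                      (coprime-∣ˡ (ℕD.divides (g ℕ.* g) n≡g²n′) n⊥d)) ⟩
    + 1 ∎
    where
    open ≡-Reasoning
    0<gcd : 0 < gcd ℤ.∣ x ∣ ℤ.∣ y ∣
    0<gcd with gcd ℤ.∣ x ∣ ℤ.∣ y ∣ in gcd≡0
    ... | suc _ = s≤s z≤n
    ... | zero = ⊥-elim (ℕP.1+n≢0 (ℤP.+-injective (begin
      + n                      ≡⟨ Fxy≡n ⟨
      eval F x y               ≡⟨ cong₂ (eval F) (ℤP.∣i∣≡0⇒i≡0 (G.gcd[m,n]≡0⇒m≡0 gcd≡0)) (ℤP.∣i∣≡0⇒i≡0 (G.gcd[m,n]≡0⇒n≡0 ℤ.∣ x ∣ gcd≡0)) ⟩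
      eval F (+ 0) (+ 0)       ≡⟨ eval-homogeneous F (+ 0) (+ 0) (+ 0) ⟩
      + 0 * + 0 * eval F (+ 0) (+ 0) ≡⟨ ℤP.*-zeroˡ (+ 0 * eval F (+ 0) (+ 0)) ⟩
      + 0 ∎)))
    open GcdDecomposition (gcdDecomposition x y 0<gcd)
    u = proj₁ (bézoutℤ x′ y′ coprime)
    w = proj₁ (proj₂ (bézoutℤ x′ y′ coprime))
    bézout = proj₂ (proj₂ (bézoutℤ x′ y′ coprime))
    n′ = proj₁ (posDef-eval-nonNeg F x′ y′ posDef)
    F[x′,y′]≡n′ = proj₂ (posDef-eval-nonNeg F x′ y′ posDef)
    n≡g²n′ : n ≡ g ℕ.* g ℕ.* n′
    n≡g²n′ = ℤP.+-injective (begin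
      + n                          ≡⟨ Fxy≡n ⟨
      eval F x y                   ≡⟨ cong₂ (eval F) x≡x′g y≡y′g ⟩
      eval F (x′ * + g) (y′ * + g) ≡⟨ eval-homogeneous F x′ y′ (+ g) ⟩
      + g * + g * eval F x′ y′     ≡⟨ cong₂ _*_ (sym (ℤP.pos-* g g)) F[x′,y′]≡n′ ⟩
      + (g ℕ.* g) * + n′           ≡⟨ ℤP.pos-* (g ℕ.* g) n′ ⟨
      + (g ℕ.* g ℕ.* n′)           ∎)
    1≤n′ = 1≤*⇒1≤ʳ (g ℕ.* g) n′ (subst (1 ≤_) n≡g²n′ (s≤s z≤n))
    g∣n : g ∣ n
    g∣n = ℕD.divides (g ℕ.* n′) (trans n≡g²n′ (trans (ℕP.*-assoc g g n′) (ℕP.*-comm g (g ℕ.* n′))))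

-- Values prime to a modulus

prime∤⇒coprime : ∀ {p n} → Prime p → ¬ (p ∣ n) → Coprime p n
prime∤⇒coprime pp p∤n {i} (i∣p , i∣n) with prime⇒irreducible pp i∣p
... | inj₁ i≡1 = i≡1
... | inj₂ refl = ⊥-elim (p∤n i∣n)

≡mod-eval : ∀ {m} F {x x′ y y′} → x ≡ x′ mod m → y ≡ y′ mod m → eval F x y ≡ eval F x′ y′ mod m
≡mod-eval (form a b c) x≡x′ y≡y′ =
  ≡mod-+ (≡mod-+ (≡mod-* (≡mod-* (≡mod-refl a) x≡x′) x≡x′) (≡mod-* (≡mod-* (≡mod-refl b) x≡x′) y≡y′))
         (≡mod-* (≡mod-* (≡mod-refl c) y≡y′) y≡y′)

coprime-≡mod : ∀ {m v w} → v ≡ w mod m → Coprime ℤ.∣ w ∣ m → Coprime ℤ.∣ v ∣ m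
coprime-≡mod {m} {v} {w} (congruent m∣v-w) w⊥m {i} (i∣v , i∣m) = w⊥m (S.∣⇒∣ᵤ {+ i} {w}
  (subst (+ i ∣ℤ_) (cancel v w) (S.∣m∣n⇒∣m-n (S.∣ᵤ⇒∣ {+ i} {v} i∣v) (S.∣-trans (∣⇒∣ℤ i∣m) m∣v-w))) , i∣m)
  where cancel : ∀ v w → v - (v - w) ≡ w
        cancel = solve-∀

-- The values F(1,0) = a, F(0,1) = c and F(1,1) = a + b + c cannot all be divisible by p.
primitive⇒prime∤value : ∀ F p → Primitive F → Prime p → Σ ℤ λ x → Σ ℤ λ y → ¬ (+ p ∣ℤ eval F x y)
primitive⇒prime∤value F@(form a b c) p prim pp
  with + p S.∣? eval F (+ 1) (+ 0) | + p S.∣? eval F (+ 0) (+ 1) | + p S.∣? eval F (+ 1) (+ 1)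
... | no p∤F[1,0] | _ | _ = + 1 , + 0 , p∤F[1,0]
... | yes _ | no p∤F[0,1] | _ = + 0 , + 1 , p∤F[0,1]
... | yes _ | yes _ | no p∤F[1,1] = + 1 , + 1 , p∤F[1,1]
... | yes p∣F[1,0] | yes p∣F[0,1] | yes p∣F[1,1] =
  ⊥-elim (ℕP.<-irrefl (sym (primitive⇒commonDivisor≡1 F prim (p∣a , p∣b , p∣c))) (prime>1 pp))
  where
  F[1,0]≡a : ∀ a b c → a * + 1 * + 1 + b * + 1 * + 0 + c * + 0 * + 0 ≡ a
  F[1,0]≡a = solve-∀
  F[0,1]≡c : ∀ a b c → a * + 0 * + 0 + b * + 0 * + 1 + c * + 1 * + 1 ≡ c
  F[0,1]≡c = solve-∀
  b≡ : ∀ a b c → (a * + 1 * + 1 + b * + 1 * + 1 + c * + 1 * + 1) - (a * + 1 * + 1 + b * + 1 * + 0 + c * + 0 * + 0)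
                  - (a * + 0 * + 0 + b * + 0 * + 1 + c * + 1 * + 1) ≡ b
  b≡ = solve-∀
  p∣a = subst (+ p ∣ℤ_) (F[1,0]≡a a b c) p∣F[1,0]
  p∣c = subst (+ p ∣ℤ_) (F[0,1]≡c a b c) p∣F[0,1]
  p∣b = subst (+ p ∣ℤ_) (b≡ a b c) (S.∣m∣n⇒∣m-n (S.∣m∣n⇒∣m-n p∣F[1,1] p∣F[1,0]) p∣F[0,1])

chineseRemainder : ∀ p M s t → s * + p + t * + M ≡ + 1 → ∀ z₀ z₁ →
  z₀ * t * + M + z₁ * s * + p ≡ z₁ mod M × z₀ * t * + M + z₁ * s * + p ≡ z₀ mod p
chineseRemainder p M s t bézout z₀ z₁ =
  congruent (divides ((z₀ - z₁) * t) (trans (splitM z₀ z₁ s t (+ p) (+ M))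
    (trans (cong (λ B → (z₀ - z₁) * t * + M + z₁ * (B - + 1)) bézout) (vanish ((z₀ - z₁) * t * + M) z₁)))) ,
  congruent (divides ((z₁ - z₀) * s) (trans (splitP z₀ z₁ s t (+ p) (+ M))
    (trans (cong (λ B → (z₁ - z₀) * s * + p + z₀ * (B - + 1)) bézout) (vanish ((z₁ - z₀) * s * + p) z₀))))
  where
  vanish : ∀ A z → A + z * (+ 1 - + 1) ≡ A
  vanish = solve-∀
  splitM : ∀ z₀ z₁ s t p M → z₀ * t * M + z₁ * s * p - z₁ ≡ (z₀ - z₁) * t * M + z₁ * (s * p + t * M - + 1)
  splitM = solve-∀
  splitP : ∀ z₀ z₁ s t p M → z₀ * t * M + z₁ * s * p - z₀ ≡ (z₁ - z₀) * s * p + z₀ * (s * p + t * M - + 1)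
  splitP = solve-∀

primitive⇒coprimeValue-product : ∀ F → Primitive F → ∀ ps → All Prime ps →
                                  Σ ℤ λ x → Σ ℤ λ y → Coprime ℤ.∣ eval F x y ∣ (product ps)
primitive⇒coprimeValue-product F prim [] [] = + 0 , + 0 , λ (_ , i∣1) → ℕD.∣1⇒≡1 i∣1
primitive⇒coprimeValue-product F prim (p ∷ ps) (pp ∷ primes)
  with primitive⇒coprimeValue-product F prim ps primes | p ∣? product ps
... | x₁ , y₁ , F[x₁,y₁]⊥P | yes p∣P =
  x₁ , y₁ , Cop.sym (coprime-*ˡ (coprime-∣ˡ p∣P (Cop.sym F[x₁,y₁]⊥P)) (Cop.sym F[x₁,y₁]⊥P))
... | x₁ , y₁ , F[x₁,y₁]⊥P | no p∤P = X , Y , Cop.sym (coprime-*ˡ (Cop.sym F[X,Y]⊥p) (Cop.sym F[X,Y]⊥P))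
  where
  P = product ps
  x₀ = proj₁ (primitive⇒prime∤value F p prim pp)
  y₀ = proj₁ (proj₂ (primitive⇒prime∤value F p prim pp))
  p∤F[x₀,y₀] = proj₂ (proj₂ (primitive⇒prime∤value F p prim pp))
  bz = bézoutℤ (+ p) (+ P) (prime∤⇒coprime pp p∤P)
  s = proj₁ bz
  t = proj₁ (proj₂ bz)
  X = x₀ * t * + P + x₁ * s * + p
  Y = y₀ * t * + P + y₁ * s * + p
  X≡ = chineseRemainder p P s t (proj₂ (proj₂ bz)) x₀ x₁
  Y≡ = chineseRemainder p P s t (proj₂ (proj₂ bz)) y₀ y₁
  F[X,Y]⊥P : Coprime ℤ.∣ eval F X Y ∣ P
  F[X,Y]⊥P = coprime-≡mod (≡mod-eval F (proj₁ X≡) (proj₁ Y≡)) F[x₁,y₁]⊥P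
  F[X,Y]⊥p : Coprime ℤ.∣ eval F X Y ∣ p
  F[X,Y]⊥p = Cop.sym (prime∤⇒coprime pp λ p∣F[X,Y] → p∤F[x₀,y₀]
    (≡0mod⇒∣ (≡mod-trans (≡mod-sym (≡mod-eval F (proj₂ X≡) (proj₂ Y≡))) (∣⇒≡0mod (S.∣ᵤ⇒∣ {+ p} {eval F X Y} p∣F[X,Y])))))

primitive⇒coprimeValue : ∀ F → Primitive F → ∀ M → 1 ≤ M → Σ ℤ λ x → Σ ℤ λ y → Coprime ℤ.∣ eval F x y ∣ M
primitive⇒coprimeValue F prim M 1≤M with primitive⇒coprimeValue-product F prim (factors P) (factorsPrime P)
  where P = spfFactorisation M 1≤M
... | x , y , ⊥product = x , y , subst (Coprime _) (sym (isFactorisation (spfFactorisation M 1≤M))) ⊥product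

-- Forms equivalent to a multiple of a primitive form

SL2Equiv-represents : ∀ Q R {r} → SL2Equiv Q R → Represents R r → Represents Q r
SL2Equiv-represents Q R (α , β , γ , δ , _ , Q∘g≡R) (x , y , Rxy≡r) =
  α * x + β * y , γ * x + δ * y ,
  trans (sym (eval-act Q α β γ δ x y)) (trans (cong (λ G → eval G x y) Q∘g≡R) Rxy≡r)

SL2Equiv-represents⁻¹ : ∀ Q R {r} → SL2Equiv Q R → Represents Q r → Represents R r
SL2Equiv-represents⁻¹ Q R (α , β , γ , δ , det≡1 , Q∘g≡R) (x , y , Qxy≡r) =
  x′ , y′ , trans (cong (λ G → eval G x′ y′) (sym Q∘g≡R))
                     (trans (eval-act Q α β γ δ x′ y′) (trans (cong₂ (eval Q) (proj₁ back) (proj₂ back)) Qxy≡r))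
  where
  x′ = δ * x - β * y
  y′ = (- γ) * x + α * y
  back = act-inverse-point α β γ δ x y det≡1

SL2Equiv-content : ∀ Q R → SL2Equiv Q R → contentℕ Q ≡ contentℕ R
SL2Equiv-content Q R (α , β , γ , δ , det≡1 , Q∘g≡R) = trans (sym (content-act Q α β γ δ det≡1)) (cong contentℕ Q∘g≡R)

coprimeTo≢1⇒1≤ : ∀ {n m} → Coprime n m → m ≢ 1 → 1 ≤ n
coprimeTo≢1⇒1≤ {zero} 0⊥m m≢1 = ⊥-elim (m≢1 (Cop.0-coprimeTo-m⇒m≡1 0⊥m))
coprimeTo≢1⇒1≤ {suc _} _ _ = s≤s z≤n

kronecker-pos : ∀ a n → 1 ≤ n → kronecker a (+ n) ≡ kronPos a n
kronecker-pos a (suc n) _ = refl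

gcd≢1⇒1<gcd : ∀ m n → 1 ≤ m → gcd m n ≢ 1 → 1 < gcd m n
gcd≢1⇒1<gcd m n 1≤m gcd≢1 with gcd m n in gcd≡
... | zero = ⊥-elim (ℕP.<-irrefl (sym (G.gcd[m,n]≡0⇒m≡0 gcd≡)) 1≤m)
... | suc zero = ⊥-elim (gcd≢1 refl)
... | suc (suc _) = s≤s (s≤s z≤n)

fundamental-odd⇒≡1mod4 : ∀ d → FundamentalDiscriminant d → ¬ (+ 2 ∣ℤ d) → d ≡ + 1 mod 4
fundamental-odd⇒≡1mod4 d (inj₁ (d%4≡1 , _)) _ =
  ≡mod-trans (≡mod-sym (%ℕ-≡mod d 4)) (subst (λ t → + t ≡ + 1 mod 4) (sym d%4≡1) (≡mod-refl (+ 1)))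
fundamental-odd⇒≡1mod4 d (inj₂ (m , d≡4m , _)) 2∤d =
  ⊥-elim (2∤d (subst (+ 2 ∣ℤ_) (sym d≡4m) (S.∣m⇒∣m*n m (divides (+ 2) refl))))

negativeFundamental-∣∣≢1 : ∀ d → FundamentalDiscriminant d → d ℤ.< + 0 → ℤ.∣ d ∣ ≢ 1
negativeFundamental-∣∣≢1 (+ _) _ (ℤ.+<+ ())
negativeFundamental-∣∣≢1 -[1+ suc n ] _ _ ()
negativeFundamental-∣∣≢1 -[1+ zero ] (inj₁ (() , _)) _ refl
negativeFundamental-∣∣≢1 -[1+ zero ] (inj₂ (m , -1≡4m , _)) _ refl =
  ℕD.>⇒∤ (from-yes (1 ℕ.<? 4)) (S.∣⇒∣ᵤ {+ 4} { -[1+ 0 ]} (subst (+ 4 ∣ℤ_) (sym -1≡4m) (S.∣m⇒∣m*n m (S.∣-refl {+ 4}))))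

module ScaledPrimitive (d : ℤ) (odd⇒≡1 : ¬ (+ 2 ∣ℤ d) → d ≡ + 1 mod 4) (1≤∣d∣ : 1 ≤ ℤ.∣ d ∣) (∣d∣≢1 : ℤ.∣ d ∣ ≢ 1)
                       (k : ℕ) (1≤k : 1 ≤ k) (Q Q′ : Form) (f : ℤ) (prim′ : Primitive Q′) (posDef′ : PosDef Q′)
                       (disc′ : disc Q′ ≡ f * f * d) (Q~kQ′ : SL2Equiv Q (scale (+ k) Q′)) where
  open LeadingCoefficient d odd⇒≡1

  content≡k : contentℕ Q ≡ k
  content≡k = begin
    contentℕ Q                   ≡⟨ SL2Equiv-content Q (scale (+ k) Q′) Q~kQ′ ⟩
    contentℕ (scale (+ k) Q′)    ≡⟨ content-scale k Q′ ⟩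
    k ℕ.* contentℕ Q′            ≡⟨ cong (k ℕ.*_) prim′ ⟩
    k ℕ.* 1                      ≡⟨ ℕP.*-identityʳ k ⟩
    k                            ∎
    where open ≡-Reasoning

  represents⇒scaledValue : ∀ r → Represents Q r → Σ ℕ λ n → Represents Q′ (+ n) × r ≡ + (k ℕ.* n)
  represents⇒scaledValue r Qr = n , (x , y , Q′xy≡n) ,
    trans (sym kQ′xy≡r) (trans (eval-scale (+ k) Q′ x y) (trans (cong (+ k *_) Q′xy≡n) (sym (ℤP.pos-* k n))))
    where
    x = proj₁ (SL2Equiv-represents⁻¹ Q (scale (+ k) Q′) Q~kQ′ Qr)
    y = proj₁ (proj₂ (SL2Equiv-represents⁻¹ Q (scale (+ k) Q′) Q~kQ′ Qr))
    kQ′xy≡r = proj₂ (proj₂ (SL2Equiv-represents⁻¹ Q (scale (+ k) Q′) Q~kQ′ Qr))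
    n = proj₁ (posDef-eval-nonNeg Q′ x y posDef′)
    Q′xy≡n = proj₂ (posDef-eval-nonNeg Q′ x y posDef′)

  genusChar-coprime : ∀ e → gcd k ℤ.∣ d ∣ ≡ 1 → GenusCharIs e d Q (kronecker d (+ k))
  genusChar-coprime e gcd≡1 = inj₁ (content⊥d , coprimeValue , character)
    where
    content⊥d : gcd (contentℕ Q) ℤ.∣ d ∣ ≡ 1
    content⊥d = trans (cong (λ t → gcd t ℤ.∣ d ∣) content≡k) gcd≡1
    k⊥d = Cop.gcd≡1⇒coprime gcd≡1
    coprimeValue : Σ ℤ λ r → Represents Q r × gcd ℤ.∣ r ∣ ℤ.∣ d ∣ ≡ 1
    coprimeValue with primitive⇒coprimeValue Q′ prim′ ℤ.∣ d ∣ 1≤∣d∣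
    ... | x , y , v⊥d = + k * eval Q′ x y ,
      SL2Equiv-represents Q (scale (+ k) Q′) Q~kQ′ (x , y , eval-scale (+ k) Q′ x y) ,
      Cop.coprime⇒gcd≡1 (subst (λ t → Coprime t ℤ.∣ d ∣) (sym (ℤP.abs-* (+ k) (eval Q′ x y)))
                                (coprime-*ˡ {k} {ℤ.∣ eval Q′ x y ∣} k⊥d v⊥d))
    character : ∀ r → Represents Q r → gcd ℤ.∣ r ∣ ℤ.∣ d ∣ ≡ 1 → kronecker d r ≡ kronecker d (+ k)
    character r Qr gcd[r,d]≡1 = begin
      kronecker d r                 ≡⟨ cong (kronecker d) r≡kn ⟩
      kronecker d (+ (k ℕ.* n))     ≡⟨ kronecker-pos d (k ℕ.* n) (ℕP.*-mono-≤ 1≤k 1≤n) ⟩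
      kronPos d (k ℕ.* n)           ≡⟨ kronPos-* d k n 1≤k 1≤n ⟩
      kronPos d k * kronPos d n     ≡⟨ cong (kronPos d k *_) (kronPos-value≡1 Q′ f prim′ posDef′ disc′ x y n Q′xy≡n n⊥d) ⟩
      kronPos d k * + 1             ≡⟨ ℤP.*-identityʳ (kronPos d k) ⟩
      kronPos d k                   ≡⟨ kronecker-pos d k 1≤k ⟨
      kronecker d (+ k)             ∎
      where
      open ≡-Reasoning
      n = proj₁ (represents⇒scaledValue r Qr)
      x = proj₁ (proj₁ (proj₂ (represents⇒scaledValue r Qr)))
      y = proj₁ (proj₂ (proj₁ (proj₂ (represents⇒scaledValue r Qr))))
      Q′xy≡n = proj₂ (proj₂ (proj₁ (proj₂ (represents⇒scaledValue r Qr))))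
      r≡kn = proj₂ (proj₂ (represents⇒scaledValue r Qr))
      n⊥d : Coprime n ℤ.∣ d ∣
      n⊥d = coprime-∣ˡ (ℕD.n∣m*n k) (Cop.gcd≡1⇒coprime (trans (cong (λ t → gcd ℤ.∣ t ∣ ℤ.∣ d ∣) (sym r≡kn)) gcd[r,d]≡1))
      1≤n : 1 ≤ n
      1≤n = coprimeTo≢1⇒1≤ n⊥d ∣d∣≢1

  genusChar-notCoprime : ∀ e → gcd k ℤ.∣ d ∣ ≢ 1 → GenusCharIs e d Q (kronecker d (+ k))
  genusChar-notCoprime e gcd≢1 = inj₂ (subst (λ t → 1 < gcd t ℤ.∣ d ∣) (sym content≡k) 1<g ,
    trans (kronecker-pos d k 1≤k)
      (kronPos≡0 d k p 1≤k pp (ℕD.∣-trans p∣g (G.gcd[m,n]∣m k ℤ.∣ d ∣))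
                    (S.∣ᵤ⇒∣ {+ p} {d} (ℕD.∣-trans p∣g (G.gcd[m,n]∣n k ℤ.∣ d ∣)))))
    where
    g = gcd k ℤ.∣ d ∣
    1<g = gcd≢1⇒1<gcd k ℤ.∣ d ∣ 1≤k gcd≢1
    p = spf g
    p∣g = proj₁ (spf-correct g 1<g)
    pp = proj₂ (spf-correct g 1<g)

  genusChar : ∀ e → GenusCharIs e d Q (kronecker d (+ k))
  genusChar e with gcd k ℤ.∣ d ∣ ℕ.≟ 1
  ... | yes gcd≡1 = genusChar-coprime e gcd≡1
  ... | no gcd≢1 = genusChar-notCoprime e gcd≢1

negative⇒1≤∣∣ : ∀ {d} → d ℤ.< + 0 → 1 ≤ ℤ.∣ d ∣
negative⇒1≤∣∣ {+ _} (ℤ.+<+ ())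
negative⇒1≤∣∣ { -[1+ _ ]} _ = s≤s z≤n

disc-quotient : ∀ k f D d .{{_ : NonZero k}} → + k * + k * D ≡ + (f ℕ.* k) * + (f ℕ.* k) * d → D ≡ + f * + f * d
disc-quotient k f D d k²D≡[fk]²d = ℤP.*-cancelˡ-≡ (+ k) _ _ (ℤP.*-cancelˡ-≡ (+ k) _ _ (begin
  + k * (+ k * D)                    ≡⟨ ℤP.*-assoc (+ k) (+ k) D ⟨
  + k * + k * D                      ≡⟨ k²D≡[fk]²d ⟩
  + (f ℕ.* k) * + (f ℕ.* k) * d      ≡⟨ cong (λ t → t * t * d) (ℤP.pos-* f k) ⟩
  + f * + k * (+ f * + k) * d        ≡⟨ regroup (+ f) (+ k) d ⟩
  + k * (+ k * (+ f * + f * d))      ∎))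
  where
  open ≡-Reasoning
  regroup : ∀ f k d → f * k * (f * k) * d ≡ k * (k * (f * f * d))
  regroup = solve-∀

lemma6p8 : (A : ℕ) → NonZero A → (D₀ : ℤ) → FundamentalDiscriminant D₀ → D₀ ℤ.< + 0
    → (Q : Form) → PosDef Q → disc Q ≡ + A * + A * D₀
    → (A_Q : ℕ) → NonZero A_Q → A_Q ∣ A
    → (Q′ : Form) → Primitive Q′ → PosDef Q′ → + A_Q * + A_Q * disc Q′ ≡ disc Q
    → SL2Equiv Q (scale (+ A_Q) Q′)
    → GenusCharIs (+ A * + A) D₀ Q (kronecker D₀ (+ A_Q))
lemma6p8 A _ D₀ fund D₀<0 Q _ discQ A_Q A_Q≢0 (ℕD.divides f refl) Q′ prim′ posDef′ discQ′ Q~A_QQ′ =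
  genusChar (+ A * + A)
  where
  instance _ = A_Q≢0
  open ScaledPrimitive D₀ (fundamental-odd⇒≡1mod4 D₀ fund) (negative⇒1≤∣∣ D₀<0) (negativeFundamental-∣∣≢1 D₀ fund D₀<0)
                       A_Q (ℕ.>-nonZero⁻¹ A_Q) Q Q′ (+ f) prim′ posDef′
                       (disc-quotient A_Q f (disc Q′) D₀ (trans discQ′ discQ)) Q~A_QQ′
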